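{- Let $\mathsf L\in\{\mathsf N_\preccurlyeq,\mathsf{NN}_\preccurlyeq,\mathsf{NT}_\preccurlyeq,\mathsf{NW}_\preccurlyeq,\mathsf{NC}_\preccurlyeq,\mathsf{NA}_\preccurlyeq,\mathsf{NNA}_\preccurlyeq\}$ and let $\mathsf{G.L}$ be the corresponding sequent calculus (without cut). If $\bigwedge\Gamma\to\bigvee\Delta$ is derivable in $\mathsf L$, then the sequent $\Gamma\Rightarrow\Delta$ is derivable in $\mathsf{G.L}$.
   Context: Language: formulas $A ::= p \mid \bot \mid A\to A \mid A \preccurlyeq A$ over countably many atoms; $\top,\neg,\wedge,\vee$ defined as usual. Hilbert systems: axioms/rules (cpr) from $A\to B$ infer $B\preccurlyeq A$; (tr) $(A\preccurlyeq B)\wedge(B\preccurlyeq C)\to(A\preccurlyeq C)$; (or) $(A\preccurlyeq B)\wedge(A\preccurlyeq C)\to(A\preccurlyeq B\vee C)$; (n) $\neg(\bot\preccurlyeq\top)$; (t) $(\bot\preccurlyeq A)\to\neg A$; (w) $A\to(A\preccurlyeq\top)$; (c) $(A\preccurlyeq\top)\to A$; (a$-$) $(A\preccurlyeq B)\to(\bot\preccurlyeq\neg(A\preccurlyeq B))$; (a) $\neg(A\preccurlyeq B)\to(\bot\preccurlyeq(A\preccurlyeq B))$. $\mathsf N_\preccurlyeq$ = classical propositional logic plus tr, or, cpr; $\mathsf{NN}_\preccurlyeq=\mathsf N_\preccurlyeq+$n; $\mathsf{NT}_\preccurlyeq=\mathsf N_\preccurlyeq+$t; $\mathsf{NW}_\preccurlyeq=\mathsf{NT}_\preccurlyeq+$w;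 $\mathsf{NC}_\preccurlyeq=\mathsf{NW}_\preccurlyeq+$c; $\mathsf{NA}_\preccurlyeq=\mathsf N_\preccurlyeq+$a$-$,a; $\mathsf{NNA}_\preccurlyeq=\mathsf{NN}_\preccurlyeq+$a$-$,a. Derivability: finite sequence of axioms, modus ponens and cpr applications. Sequents $\Gamma\Rightarrow\Delta$: $\Gamma,\Delta$ finite multisets of formulas. Rules (write $\Sigma^{\preccurlyeq}$ for $C_1\preccurlyeq D_1,\dots,C_n\preccurlyeq D_n$; $\Gamma^{\preccurlyeq}$, $\Delta^{\preccurlyeq}$ for the $\preccurlyeq$-formulas in $\Gamma$, $\Delta$): init: $\Gamma,p\Rightarrow p,\Delta$; $\bot_L$: $\Gamma,\bot\Rightarrow\Delta$; $\to_L$: from $\Gamma\Rightarrow A,\Delta$ and $\Gamma,B\Rightarrow\Delta$ infer $\Gamma,A\to B\Rightarrow\Delta$; $\to_R$: from $\Gamma,A\Rightarrow B,\Delta$ infer $\Gamma\Rightarrow A\to B,\Delta$. $\mathrm{CP}_n$: from $\{C_k\Rightarrow A,D_1,\dots,D_{k-1}\}_{1\le k\le n}$ and $B\Rightarrow A,D_1,\dots,D_n$ infer $\Gamma,\Sigma^{\preccurlyeq}\Rightarrow A\preccurlyeq B,\Delta$. $\mathrm N_n$: from $\{C_k\Rightarrow D_1,\dots,D_{k-1}\}_{k\le n}$ and $\Rightarrow D_1,\dots,D_n$ infer $\Gamma,\Sigma^{\preccurlyeq}\Rightarrow\Delta$. $\mathrm T_n$: from $\{C_k\Rightarrow D_1,\dots,D_{k-1}\}_{k\le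 n}$ and $\Gamma,\Sigma^{\preccurlyeq}\Rightarrow D_1,\dots,D_n,\Delta$ infer $\Gamma,\Sigma^{\preccurlyeq}\Rightarrow\Delta$. $\mathrm W_n$: from $\{C_k\Rightarrow A,D_1,\dots,D_{k-1}\}_{k\le n}$ and $\Gamma,\Sigma^{\preccurlyeq}\Rightarrow A,A\preccurlyeq B,D_1,\dots,D_n,\Delta$ infer $\Gamma,\Sigma^{\preccurlyeq}\Rightarrow A\preccurlyeq B,\Delta$. $\mathrm W_0$: from $\Gamma\Rightarrow A\preccurlyeq B,A,\Delta$ infer $\Gamma\Rightarrow A\preccurlyeq B,\Delta$. $\mathrm C_0$: from $\Gamma,A\preccurlyeq B,A\Rightarrow\Delta$ and $\Gamma,A\preccurlyeq B\Rightarrow B,\Delta$ infer $\Gamma,A\preccurlyeq B\Rightarrow\Delta$. $\mathrm A_n$: from $\{\Gamma^{\preccurlyeq},\Sigma^{\preccurlyeq},C_k\Rightarrow A\preccurlyeq B,A,D_1,\dots,D_{k-1},\Delta^{\preccurlyeq}\}_{k\le n}$ and $\Gamma^{\preccurlyeq},\Sigma^{\preccurlyeq},B\Rightarrow A\preccurlyeq B,A,D_1,\dots,D_n,\Delta^{\preccurlyeq}$ infer $\Gamma,\Sigma^{\preccurlyeq}\Rightarrow A\preccurlyeq B,\Delta$. $\mathrm N^A_n$: from $\{\Gamma^{\preccurlyeq},\Sigma^{\preccurlyeq},C_k\Rightarrow D_1,\dots,D_{k-1},\Delta^{\preccurlyeq}\}_{k\le n}$ and $\Gamma^{\preccurlyeq},\Sigma^{\preccurlyeq}\Rightarrow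 D_1,\dots,D_n,\Delta^{\preccurlyeq}$ infer $\Gamma,\Sigma^{\preccurlyeq}\Rightarrow\Delta$. Calculi: $\mathsf{G.N}=\{\mathrm{init},\bot_L,\to_L,\to_R\}\cup\{\mathrm{CP}_n\mid n\ge0\}$; $\mathsf{G.NN}=\mathsf{G.N}\cup\{\mathrm N_n\mid n\ge1\}$; $\mathsf{G.NT}=\mathsf{G.N}\cup\{\mathrm T_n\mid n\ge1\}$; $\mathsf{G.NW}=\mathsf{G.N}\cup\{\mathrm W_n\mid n\ge0\}\cup\{\mathrm T_n\mid n\ge1\}$; $\mathsf{G.NC}=\mathsf{G.N}\cup\{\mathrm W_0,\mathrm C_0\}$; $\mathsf{G.NA}=\{\mathrm{init},\bot_L,\to_L,\to_R\}\cup\{\mathrm A_n\mid n\ge0\}$; $\mathsf{G.NNA}=\mathsf{G.NA}\cup\{\mathrm N^A_n\mid n\ge1\}$. The calculus corresponding to $\mathsf N X_\preccurlyeq$ is $\mathsf{G.N}X$. -}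

module Defs where

open import Data.Nat using (ℕ; zero; suc; _<_)
open import Data.Fin using (Fin; toℕ)
open import Data.List using (List; []; _∷_; _++_; map; take; length; lookup)
open import Data.Product using (_×_; _,_; proj₁; proj₂)
open import Data.Unit using (⊤; tt)
open import Data.Empty using (⊥)
open import Data.List.Relation.Binary.Permutation.Propositional using (_↭_)

infixr 20 _⊃_
infix  25 _≼_

data Fm : Set where
  atom : ℕ → Fm
  bot  : Fm
  _⊃_  : Fm → Fm → Fm
  _≼_  : Fm → Fm → Fm

¬' : Fm → Fm
¬' A = A ⊃ bot

top : Fm
top = ¬' bot

_∨'_ : Fm → Fm → Fm
A ∨' B = ¬' A ⊃ B

_∧'_ : Fm → Fm → Fm
A ∧' B = ¬' (A ⊃ ¬' B)

⋀ : List Fm → Fm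
⋀ []      = top
⋀ (A ∷ Γ) = A ∧' ⋀ Γ

⋁ : List Fm → Fm
⋁ []      = bot
⋁ (A ∷ Δ) = A ∨' ⋁ Δ

-- The seven systems (a Hilbert logic L and its calculus G.L share a tag)

data Sys : Set where
  N NN NT NW NC NA NNA : Sys

hasN : Sys → Set
hasN NN  = ⊤
hasN NNA = ⊤
hasN _   = ⊥

hasT : Sys → Set
hasT NT = ⊤
hasT NW = ⊤
hasT NC = ⊤
hasT _  = ⊥

hasW : Sys → Set
hasW NW = ⊤
hasW NC = ⊤
hasW _  = ⊥

hasC : Sys → Set
hasC NC = ⊤
hasC _  = ⊥

hasA : Sys → Set
hasA NA  = ⊤
hasA NNA = ⊤
hasA _   = ⊥

-- L ⊢H A : A is derivable in the Hilbert system L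
-- Classical propositional logic is axiomatised by K, S, and double negation
-- (complete for the {⊥, →} fragment, treating ≼-formulas as atoms).
infix 4 _⊢H_
data _⊢H_ (L : Sys) : Fm → Set where
  axK  : ∀ A B → L ⊢H A ⊃ (B ⊃ A)
  axS  : ∀ A B C → L ⊢H (A ⊃ (B ⊃ C)) ⊃ ((A ⊃ B) ⊃ (A ⊃ C))
  axDN : ∀ A → L ⊢H ¬' (¬' A) ⊃ A
  mp   : ∀ {A B} → L ⊢H A ⊃ B → L ⊢H A → L ⊢H B
  cpr  : ∀ {A B} → L ⊢H A ⊃ B → L ⊢H B ≼ A
  axTr : ∀ A B C → L ⊢H ((A ≼ B) ∧' (B ≼ C)) ⊃ (A ≼ C)
  axOr : ∀ A B C → L ⊢H ((A ≼ B) ∧' (A ≼ C)) ⊃ (A ≼ (B ∨' C))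
  axN  : hasN L → L ⊢H ¬' (bot ≼ top)
  axT  : hasT L → ∀ A → L ⊢H (bot ≼ A) ⊃ ¬' A
  axW  : hasW L → ∀ A → L ⊢H A ⊃ (A ≼ top)
  axC  : hasC L → ∀ A → L ⊢H (A ≼ top) ⊃ A
  axA- : hasA L → ∀ A B → L ⊢H (A ≼ B) ⊃ (bot ≼ ¬' (A ≼ B))
  axA  : hasA L → ∀ A B → L ⊢H ¬' (A ≼ B) ⊃ (bot ≼ (A ≼ B))

-- Sequent calculi (cut-free).  Sequents are pairs of lists; multiset
-- reading is obtained via the structural permutation rule `perm`.

hasCPr : Sys → Set
hasCPr NA  = ⊥
hasCPr NNA = ⊥
hasCPr _   = ⊤

hasNr : Sys → Set
hasNr NN = ⊤
hasNr _  = ⊥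

hasTr : Sys → Set
hasTr NT = ⊤
hasTr NW = ⊤
hasTr _  = ⊥

hasWnr : Sys → Set
hasWnr NW = ⊤
hasWnr _  = ⊥

hasW0C0r : Sys → Set
hasW0C0r NC = ⊤
hasW0C0r _  = ⊥

hasAr : Sys → Set
hasAr NA  = ⊤
hasAr NNA = ⊤
hasAr _   = ⊥

hasNAr : Sys → Set
hasNAr NNA = ⊤
hasNAr _   = ⊥

Σ≼ : List (Fm × Fm) → List Fm
Σ≼ = map (λ p → proj₁ p ≼ proj₂ p)

Cs : List (Fm × Fm) → List Fm
Cs = map proj₁

Ds : List (Fm × Fm) → List Fm
Ds = map proj₂

-- C_{i+1} and D₁,…,D_i  (0-based index i)
Cat : (Σ : List (Fm × Fm)) → Fin (length Σ) → Fm
Cat Σ i = proj₁ (lookup Σ i)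

Dbefore : (Σ : List (Fm × Fm)) → Fin (length Σ) → List Fm
Dbefore Σ i = take (toℕ i) (Ds Σ)

prefs : List Fm → List Fm
prefs []            = []
prefs (atom _ ∷ Γ)  = prefs Γ
prefs (bot ∷ Γ)     = prefs Γ
prefs (_ ⊃ _ ∷ Γ)   = prefs Γ
prefs (A ≼ B ∷ Γ)   = (A ≼ B) ∷ prefs Γ

infix 4 _⊢_⇒_
data _⊢_⇒_ (G : Sys) : List Fm → List Fm → Set where
  perm : ∀ {Γ Γ' Δ Δ'} → Γ ↭ Γ' → Δ ↭ Δ' → G ⊢ Γ ⇒ Δ → G ⊢ Γ' ⇒ Δ'
  init : ∀ Γ Δ p → G ⊢ atom p ∷ Γ ⇒ atom p ∷ Δ
  botL : ∀ Γ Δ → G ⊢ bot ∷ Γ ⇒ Δ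
  impL : ∀ {Γ Δ A B} → G ⊢ Γ ⇒ A ∷ Δ → G ⊢ B ∷ Γ ⇒ Δ → G ⊢ (A ⊃ B) ∷ Γ ⇒ Δ
  impR : ∀ {Γ Δ A B} → G ⊢ A ∷ Γ ⇒ B ∷ Δ → G ⊢ Γ ⇒ (A ⊃ B) ∷ Δ
  CP   : hasCPr G → ∀ Γ Δ A B (Σ : List (Fm × Fm)) →
         ((i : Fin (length Σ)) → G ⊢ Cat Σ i ∷ [] ⇒ A ∷ Dbefore Σ i) →
         G ⊢ B ∷ [] ⇒ A ∷ Ds Σ →
         G ⊢ Γ ++ Σ≼ Σ ⇒ (A ≼ B) ∷ Δ
  Nr   : hasNr G → ∀ Γ Δ (Σ : List (Fm × Fm)) → 0 < length Σ →
         ((i : Fin (length Σ)) → G ⊢ Cat Σ i ∷ [] ⇒ Dbefore Σ i) →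
         G ⊢ [] ⇒ Ds Σ →
         G ⊢ Γ ++ Σ≼ Σ ⇒ Δ
  Tr   : hasTr G → ∀ Γ Δ (Σ : List (Fm × Fm)) → 0 < length Σ →
         ((i : Fin (length Σ)) → G ⊢ Cat Σ i ∷ [] ⇒ Dbefore Σ i) →
         G ⊢ Γ ++ Σ≼ Σ ⇒ Ds Σ ++ Δ →
         G ⊢ Γ ++ Σ≼ Σ ⇒ Δ
  Wn   : hasWnr G → ∀ Γ Δ A B (Σ : List (Fm × Fm)) →
         ((i : Fin (length Σ)) → G ⊢ Cat Σ i ∷ [] ⇒ A ∷ Dbefore Σ i) →
         G ⊢ Γ ++ Σ≼ Σ ⇒ A ∷ (A ≼ B) ∷ Ds Σ ++ Δ →
         G ⊢ Γ ++ Σ≼ Σ ⇒ (A ≼ B) ∷ Δ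
  W0   : hasW0C0r G → ∀ Γ Δ A B →
         G ⊢ Γ ⇒ (A ≼ B) ∷ A ∷ Δ →
         G ⊢ Γ ⇒ (A ≼ B) ∷ Δ
  C0   : hasW0C0r G → ∀ Γ Δ A B →
         G ⊢ (A ≼ B) ∷ A ∷ Γ ⇒ Δ →
         G ⊢ (A ≼ B) ∷ Γ ⇒ B ∷ Δ →
         G ⊢ (A ≼ B) ∷ Γ ⇒ Δ
  Ar   : hasAr G → ∀ Γ Δ A B (Σ : List (Fm × Fm)) →
         ((i : Fin (length Σ)) →
            G ⊢ prefs Γ ++ Σ≼ Σ ++ Cat Σ i ∷ [] ⇒
                (A ≼ B) ∷ A ∷ Dbefore Σ i ++ prefs Δ) →
         G ⊢ prefs Γ ++ Σ≼ Σ ++ B ∷ [] ⇒ (A ≼ B) ∷ A ∷ Ds Σ ++ prefs Δ →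
         G ⊢ Γ ++ Σ≼ Σ ⇒ (A ≼ B) ∷ Δ
  NAr  : hasNAr G → ∀ Γ Δ (Σ : List (Fm × Fm)) → 0 < length Σ →
         ((i : Fin (length Σ)) →
            G ⊢ prefs Γ ++ Σ≼ Σ ++ Cat Σ i ∷ [] ⇒ Dbefore Σ i ++ prefs Δ) →
         G ⊢ prefs Γ ++ Σ≼ Σ ⇒ Ds Σ ++ prefs Δ →
         G ⊢ Γ ++ Σ≼ Σ ⇒ Δ

-- Read contexts as sets and record derivation heights: in the resulting
-- calculus weakening, contraction and the inversion of the implication rules
-- preserve height.  There cut is admissible, by induction on the cut formula
-- and then on the heights of the two premises.  The only delicate cases are
-- principal cuts on A ≼ B against a ≼-rule using A ≼ B among its Σ: the
-- premises of the left rule are spliced into the right rule in place of the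
-- pair (A , B), with cuts on A and B reconnecting the premises.  Hilbert
-- axioms are derivable, and modus ponens and cpr become cuts, so ⋀ Γ ⊃ ⋁ Δ
-- yields Γ ⇒ Δ by one more cut.  Finally a set-based derivation becomes a
-- multiset one by permuting contexts, after removing repeated pairs from
-- each Σ so that Σ≼ Σ is a genuine sub-multiset of the antecedent.

module Submission where

open import Defs
open import Data.Nat using (ℕ; zero; suc; _<_; _≤_; z≤n; s≤s; _⊔_; _≤′_; ≤′-refl; ≤′-step) renaming (_≟_ to _≟ℕ_)
open import Data.Nat.Properties using (≤-trans; m≤m⊔n; m≤n⊔m; ≤⇒≤′)
open import Data.List using (List; []; _∷_; _++_; length; take)
open import Data.List.Properties using (++-identityʳ)
open import Data.List.Membership.Propositional using (_∈_; _∉_)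
open import Data.List.Membership.Propositional.Properties using (∈-++⁺ˡ; ∈-++⁺ʳ; ∈-++⁻; ∈-∃++)
open import Data.List.Relation.Binary.Subset.Propositional {A = Fm} using (_⊆_)
open import Data.List.Relation.Binary.Subset.Propositional.Properties using (⊆-refl; ⊆-trans; ∷⁺ʳ; ∈-∷⁺ʳ; ⊆∷∧∉⇒⊆; ⊆-reflexive-↭)
open import Data.List.Relation.Unary.Any using (here; there)
open import Data.List.Relation.Binary.Permutation.Propositional using (_↭_; ↭-sym; ↭-trans; ↭-refl; ↭-prep; ↭-reflexive)
open import Data.List.Relation.Binary.Permutation.Propositional.Properties using (shift)
open import Data.Product using (_×_; _,_; proj₁; proj₂; Σ-syntax)
open import Data.Sum using (_⊎_; inj₁; inj₂)
open import Data.Unit using (⊤; tt)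
open import Data.Empty using (⊥; ⊥-elim)
open import Data.Fin using (Fin; toℕ) renaming (zero to fzero; suc to fsuc)
open import Relation.Nullary using (¬_; Dec; yes; no)
open import Relation.Nullary.Decidable using (map′; _×-dec_)
open import Relation.Binary.PropositionalEquality using (_≡_; refl; cong; cong₂; sym)

++⊆ : ∀ {xs ys zs} → xs ⊆ zs → ys ⊆ zs → xs ++ ys ⊆ zs
++⊆ {xs = xs} p q i with ∈-++⁻ xs i
... | inj₁ j = p j
... | inj₂ j = q j

swap⊆ : ∀ {x y xs} → x ∷ y ∷ xs ⊆ y ∷ x ∷ xs
swap⊆ (here e) = there (here e)
swap⊆ (there (here e)) = here e
swap⊆ (there (there i)) = there (there i)

dup⊆ : ∀ {x xs} → x ∷ x ∷ xs ⊆ x ∷ xs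
dup⊆ (here e) = here e
dup⊆ (there i) = i

atom-injective : ∀ {p q} → atom p ≡ atom q → p ≡ q
atom-injective refl = refl

⊃-injective : ∀ {A B C D} → A ⊃ B ≡ C ⊃ D → (A ≡ C) × (B ≡ D)
⊃-injective refl = refl , refl

≼-injective : ∀ {A B C D} → A ≼ B ≡ C ≼ D → (A ≡ C) × (B ≡ D)
≼-injective refl = refl , refl

_≟_ : (A B : Fm) → Dec (A ≡ B)
atom p ≟ atom q = map′ (cong atom) atom-injective (p ≟ℕ q)
bot ≟ bot = yes refl
(A ⊃ B) ≟ (C ⊃ D) = map′ (λ (e , f) → cong₂ _⊃_ e f) ⊃-injective (A ≟ C ×-dec B ≟ D)
(A ≼ B) ≟ (C ≼ D) = map′ (λ (e , f) → cong₂ _≼_ e f) ≼-injective (A ≟ C ×-dec B ≟ D)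
atom _ ≟ bot = no λ ()
atom _ ≟ (_ ⊃ _) = no λ ()
atom _ ≟ (_ ≼ _) = no λ ()
bot ≟ atom _ = no λ ()
bot ≟ (_ ⊃ _) = no λ ()
bot ≟ (_ ≼ _) = no λ ()
(_ ⊃ _) ≟ atom _ = no λ ()
(_ ⊃ _) ≟ bot = no λ ()
(_ ⊃ _) ≟ (_ ≼ _) = no λ ()
(_ ≼ _) ≟ atom _ = no λ ()
(_ ≼ _) ≟ bot = no λ ()
(_ ≼ _) ≟ (_ ⊃ _) = no λ ()

open import Data.List.Membership.DecPropositional _≟_ using (_∈?_)

Is≼ : Fm → Set
Is≼ (_ ≼ _) = ⊤
Is≼ _ = ⊥

∈-prefs⁻ : ∀ {x} Γ → x ∈ prefs Γ → x ∈ Γ × Is≼ x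
∈-prefs⁻ [] ()
∈-prefs⁻ (atom _ ∷ Γ) i with ∈-prefs⁻ Γ i
... | j , p = there j , p
∈-prefs⁻ (bot ∷ Γ) i with ∈-prefs⁻ Γ i
... | j , p = there j , p
∈-prefs⁻ ((_ ⊃ _) ∷ Γ) i with ∈-prefs⁻ Γ i
... | j , p = there j , p
∈-prefs⁻ ((_ ≼ _) ∷ Γ) (here refl) = here refl , tt
∈-prefs⁻ ((_ ≼ _) ∷ Γ) (there i) with ∈-prefs⁻ Γ i
... | j , p = there j , p

∈-prefs⁺ : ∀ {x} Γ → x ∈ Γ → Is≼ x → x ∈ prefs Γ
∈-prefs⁺ (atom _ ∷ Γ) (here refl) ()
∈-prefs⁺ (bot ∷ Γ) (here refl) ()
∈-prefs⁺ ((_ ⊃ _) ∷ Γ) (here refl) ()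
∈-prefs⁺ ((_ ≼ _) ∷ Γ) (here refl) p = here refl
∈-prefs⁺ (atom _ ∷ Γ) (there i) p = ∈-prefs⁺ Γ i p
∈-prefs⁺ (bot ∷ Γ) (there i) p = ∈-prefs⁺ Γ i p
∈-prefs⁺ ((_ ⊃ _) ∷ Γ) (there i) p = ∈-prefs⁺ Γ i p
∈-prefs⁺ ((_ ≼ _) ∷ Γ) (there i) p = there (∈-prefs⁺ Γ i p)

prefs-mono : ∀ {Γ Γ'} → Γ ⊆ Γ' → prefs Γ ⊆ prefs Γ'
prefs-mono {Γ} {Γ'} s i with ∈-prefs⁻ Γ i
... | j , p = ∈-prefs⁺ Γ' (s j) p

prefs⊆ : ∀ Γ → prefs Γ ⊆ Γ
prefs⊆ Γ i = proj₁ (∈-prefs⁻ Γ i)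

∈-Σ≼⇒Is≼ : ∀ Σ {x} → x ∈ Σ≼ Σ → Is≼ x
∈-Σ≼⇒Is≼ ((C , D) ∷ Σ) (here refl) = tt
∈-Σ≼⇒Is≼ (_ ∷ Σ) (there i) = ∈-Σ≼⇒Is≼ Σ i

Σ≼⊆prefs : ∀ Σ Γ → Σ≼ Σ ⊆ Γ → Σ≼ Σ ⊆ prefs Γ
Σ≼⊆prefs Σ Γ s i = ∈-prefs⁺ Γ (s i) (∈-Σ≼⇒Is≼ Σ i)

-- Set-based derivations of bounded height

-- Chain Q Σ acc collects the premises Q Cₖ (Dₖ₋₁ ∷ … ∷ D₁ ∷ acc) of a
-- ≼-rule over Σ = (C₁ , D₁) ∷ … ∷ (Cₙ , Dₙ) ∷ [].
data Chain (Q : Fm → List Fm → Set) : List (Fm × Fm) → List Fm → Set where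
  []  : ∀ {acc} → Chain Q [] acc
  _∷_ : ∀ {C D Σ acc} → Q C acc → Chain Q Σ (D ∷ acc) → Chain Q ((C , D) ∷ Σ) acc

chain-map : ∀ {Q Q' : Fm → List Fm → Set} → (∀ {C a} → Q C a → Q' C a) → ∀ {Σ acc} → Chain Q Σ acc → Chain Q' Σ acc
chain-map f [] = []
chain-map f (q ∷ ch) = f q ∷ chain-map f ch

data HDer (S : Sys) : ℕ → List Fm → List Fm → Set where
  init : ∀ {n Γ Δ p} → atom p ∈ Γ → atom p ∈ Δ → HDer S n Γ Δ
  botL : ∀ {n Γ Δ} → bot ∈ Γ → HDer S n Γ Δ
  impL : ∀ {n Γ Δ A B} → (A ⊃ B) ∈ Γ → HDer S n Γ (A ∷ Δ) → HDer S n (B ∷ Γ) Δ → HDer S (suc n) Γ Δ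
  impR : ∀ {n Γ Δ A B} → (A ⊃ B) ∈ Δ → HDer S n (A ∷ Γ) (B ∷ Δ) → HDer S (suc n) Γ Δ
  cp   : hasCPr S → ∀ {n Γ Δ A B Σ} → (A ≼ B) ∈ Δ → Σ≼ Σ ⊆ Γ →
         Chain (λ C acc → HDer S n (C ∷ []) (A ∷ acc)) Σ [] →
         HDer S n (B ∷ []) (A ∷ Ds Σ) → HDer S (suc n) Γ Δ
  nr   : hasNr S → ∀ {n Γ Δ Σ} → 0 < length Σ → Σ≼ Σ ⊆ Γ →
         Chain (λ C acc → HDer S n (C ∷ []) acc) Σ [] →
         HDer S n [] (Ds Σ) → HDer S (suc n) Γ Δ
  tr   : hasTr S → ∀ {n Γ Δ Σ} → Σ≼ Σ ⊆ Γ →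
         Chain (λ C acc → HDer S n (C ∷ []) acc) Σ [] →
         HDer S n Γ (Ds Σ ++ Δ) → HDer S (suc n) Γ Δ
  wn   : hasWnr S → ∀ {n Γ Δ A B Σ} → (A ≼ B) ∈ Δ → Σ≼ Σ ⊆ Γ →
         Chain (λ C acc → HDer S n (C ∷ []) (A ∷ acc)) Σ [] →
         HDer S n Γ (A ∷ Ds Σ ++ Δ) → HDer S (suc n) Γ Δ
  w0   : hasW0C0r S → ∀ {n Γ Δ A B} → (A ≼ B) ∈ Δ → HDer S n Γ (A ∷ Δ) → HDer S (suc n) Γ Δ
  c0   : hasW0C0r S → ∀ {n Γ Δ A B} → (A ≼ B) ∈ Γ → HDer S n (A ∷ Γ) Δ → HDer S n Γ (B ∷ Δ) → HDer S (suc n) Γ Δ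
  ar   : hasAr S → ∀ {n Γ Δ A B Σ} → (A ≼ B) ∈ Δ → Σ≼ Σ ⊆ Γ →
         Chain (λ C acc → HDer S n (C ∷ prefs Γ) (A ∷ acc ++ prefs Δ)) Σ [] →
         HDer S n (B ∷ prefs Γ) (A ∷ Ds Σ ++ prefs Δ) → HDer S (suc n) Γ Δ
  nar  : hasNAr S → ∀ {n Γ Δ Σ} → 0 < length Σ → Σ≼ Σ ⊆ Γ →
         Chain (λ C acc → HDer S n (C ∷ prefs Γ) (acc ++ prefs Δ)) Σ [] →
         HDer S n (prefs Γ) (Ds Σ ++ prefs Δ) → HDer S (suc n) Γ Δ

chain-mapWith : ∀ {Q Q' : Fm → List Fm → Set} (R : List Fm → List Fm → Set) →
  (∀ {D acc acc'} → R acc acc' → R (D ∷ acc) (D ∷ acc')) →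
  (∀ {C acc acc'} → R acc acc' → Q C acc → Q' C acc') →
  ∀ {Σ acc acc'} → R acc acc' → Chain Q Σ acc → Chain Q' Σ acc'
chain-mapWith R step f r [] = []
chain-mapWith R step f r (q ∷ ch) = f r q ∷ chain-mapWith R step f (step r) ch

chain-map⊆ : ∀ {Q Q' : Fm → List Fm → Set} →
  (∀ {C acc acc'} → acc ⊆ acc' → Q C acc → Q' C acc') →
  ∀ {Σ acc acc'} → acc ⊆ acc' → Chain Q Σ acc → Chain Q' Σ acc'
chain-map⊆ f = chain-mapWith _⊆_ (∷⁺ʳ _) f

weaken : ∀ {S n Γ Δ Γ' Δ'} → HDer S n Γ Δ → Γ ⊆ Γ' → Δ ⊆ Δ' → HDer S n Γ' Δ'
weaken (init i j) s t = init (s i) (t j)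
weaken (botL i) s t = botL (s i)
weaken {n = suc n} (impL i d e) s t = impL (s i) (weaken d s (∷⁺ʳ _ t)) (weaken e (∷⁺ʳ _ s) t)
weaken {n = suc n} (impR i d) s t = impR (t i) (weaken d (∷⁺ʳ _ s) (∷⁺ʳ _ t))
weaken {n = suc n} (cp h i σ ch d) s t = cp h (t i) (⊆-trans σ s) ch d
weaken {n = suc n} (nr h l σ ch d) s t = nr h l (⊆-trans σ s) ch d
weaken {n = suc n} {Δ = Δ} (tr h {Σ = Σ} σ ch d) s t = tr h (⊆-trans σ s) ch (weaken d s (++⊆ ∈-++⁺ˡ (⊆-trans t (∈-++⁺ʳ (Ds Σ)))))
weaken {n = suc n} (wn h {Σ = Σ} i σ ch d) s t = wn h (t i) (⊆-trans σ s) ch (weaken d s (∷⁺ʳ _ (++⊆ ∈-++⁺ˡ (⊆-trans t (∈-++⁺ʳ (Ds Σ))))))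
weaken {n = suc n} (w0 h i d) s t = w0 h (t i) (weaken d s (∷⁺ʳ _ t))
weaken {n = suc n} (c0 h i d e) s t = c0 h (s i) (weaken d (∷⁺ʳ _ s) t) (weaken e s (∷⁺ʳ _ t))
weaken {n = suc n} {Γ} {Δ} {Γ'} {Δ'} (ar h {Σ = Σ} i σ ch d) s t =
  ar h (t i) (⊆-trans σ s)
     (chain-map⊆ (λ {C} {acc} {acc'} u q → weaken q (∷⁺ʳ _ (prefs-mono s)) (∷⁺ʳ _ (++⊆ (⊆-trans u ∈-++⁺ˡ) (⊆-trans (prefs-mono t) (∈-++⁺ʳ acc'))))) ⊆-refl ch)
     (weaken d (∷⁺ʳ _ (prefs-mono s)) (∷⁺ʳ _ (++⊆ ∈-++⁺ˡ (⊆-trans (prefs-mono t) (∈-++⁺ʳ (Ds Σ))))))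
weaken {n = suc n} {Γ} {Δ} {Γ'} {Δ'} (nar h {Σ = Σ} l σ ch d) s t =
  nar h l (⊆-trans σ s)
     (chain-map⊆ (λ {C} {acc} {acc'} u q → weaken q (∷⁺ʳ _ (prefs-mono s)) (++⊆ (⊆-trans u ∈-++⁺ˡ) (⊆-trans (prefs-mono t) (∈-++⁺ʳ acc')))) ⊆-refl ch)
     (weaken d (prefs-mono s) (++⊆ ∈-++⁺ˡ (⊆-trans (prefs-mono t) (∈-++⁺ʳ (Ds Σ)))))

raise : ∀ {S n Γ Δ} → HDer S n Γ Δ → HDer S (suc n) Γ Δ
raise (init i j) = init i j
raise (botL i) = botL i
raise {n = suc n} (impL i d e) = impL i (raise d) (raise e)
raise {n = suc n} (impR i d) = impR i (raise d)
raise {n = suc n} (cp h i σ ch d) = cp h i σ (chain-map⊆ (λ u q → weaken (raise q) ⊆-refl (∷⁺ʳ _ u)) ⊆-refl ch) (raise d)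
raise {n = suc n} (nr h l σ ch d) = nr h l σ (chain-map⊆ (λ u q → weaken (raise q) ⊆-refl u) ⊆-refl ch) (raise d)
raise {n = suc n} (tr h σ ch d) = tr h σ (chain-map⊆ (λ u q → weaken (raise q) ⊆-refl u) ⊆-refl ch) (raise d)
raise {n = suc n} (wn h i σ ch d) = wn h i σ (chain-map⊆ (λ u q → weaken (raise q) ⊆-refl (∷⁺ʳ _ u)) ⊆-refl ch) (raise d)
raise {n = suc n} (w0 h i d) = w0 h i (raise d)
raise {n = suc n} (c0 h i d e) = c0 h i (raise d) (raise e)
raise {n = suc n} (ar h i σ ch d) = ar h i σ (chain-map⊆ (λ {_} {acc} {acc'} u q → weaken (raise q) ⊆-refl (∷⁺ʳ _ (++⊆ (⊆-trans u ∈-++⁺ˡ) (∈-++⁺ʳ acc')))) ⊆-refl ch) (raise d)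
raise {n = suc n} (nar h l σ ch d) = nar h l σ (chain-map⊆ (λ {_} {acc} {acc'} u q → weaken (raise q) ⊆-refl (++⊆ (⊆-trans u ∈-++⁺ˡ) (∈-++⁺ʳ acc'))) ⊆-refl ch) (raise d)

raise≤′ : ∀ {S n m Γ Δ} → n ≤′ m → HDer S n Γ Δ → HDer S m Γ Δ
raise≤′ ≤′-refl d = d
raise≤′ (≤′-step le) d = raise (raise≤′ le d)

raise≤ : ∀ {S n m Γ Δ} → n ≤ m → HDer S n Γ Δ → HDer S m Γ Δ
raise≤ le = raise≤′ (≤⇒≤′ le)

prefs-∷ : ∀ x Γ → prefs Γ ⊆ prefs (x ∷ Γ)
prefs-∷ x Γ = prefs-mono {Γ} {x ∷ Γ} there

ar-prefs⊆ : ∀ {S n} Γ Δ {Γ' Δ' A B Σ} → hasAr S → (A ≼ B) ∈ Δ' → Σ≼ Σ ⊆ Γ' →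
  prefs Γ ⊆ prefs Γ' → prefs Δ ⊆ prefs Δ' →
  Chain (λ C acc → HDer S n (C ∷ prefs Γ) (A ∷ acc ++ prefs Δ)) Σ [] →
  HDer S n (B ∷ prefs Γ) (A ∷ Ds Σ ++ prefs Δ) → HDer S (suc n) Γ' Δ'
ar-prefs⊆ Γ Δ {Σ = Σ} h i σ s t ch d =
  ar h i σ (chain-map⊆ (λ {_} {acc} {acc'} u q → weaken q (∷⁺ʳ _ s) (∷⁺ʳ _ (++⊆ (⊆-trans u ∈-++⁺ˡ) (⊆-trans t (∈-++⁺ʳ acc'))))) ⊆-refl ch)
           (weaken d (∷⁺ʳ _ s) (∷⁺ʳ _ (++⊆ ∈-++⁺ˡ (⊆-trans t (∈-++⁺ʳ (Ds Σ))))))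

nar-prefs⊆ : ∀ {S n} Γ Δ {Γ' Δ' Σ} → hasNAr S → 0 < length Σ → Σ≼ Σ ⊆ Γ' →
  prefs Γ ⊆ prefs Γ' → prefs Δ ⊆ prefs Δ' →
  Chain (λ C acc → HDer S n (C ∷ prefs Γ) (acc ++ prefs Δ)) Σ [] →
  HDer S n (prefs Γ) (Ds Σ ++ prefs Δ) → HDer S (suc n) Γ' Δ'
nar-prefs⊆ Γ Δ {Σ = Σ} h l σ s t ch d =
  nar h l σ (chain-map⊆ (λ {_} {acc} {acc'} u q → weaken q (∷⁺ʳ _ s) (++⊆ (⊆-trans u ∈-++⁺ˡ) (⊆-trans t (∈-++⁺ʳ acc')))) ⊆-refl ch)
           (weaken d s (++⊆ ∈-++⁺ˡ (⊆-trans t (∈-++⁺ʳ (Ds Σ)))))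

⊆∷-≢ : ∀ {X x Γ Γ'} → Γ ⊆ X ∷ Γ' → x ∈ Γ → ¬ (x ≡ X) → x ∈ Γ'
⊆∷-≢ s i ne with s i
... | here e = ⊥-elim (ne e)
... | there j = j

⊆⊃∷-Is≼ : ∀ {A B x Γ Γ'} → Γ ⊆ (A ⊃ B) ∷ Γ' → x ∈ Γ → Is≼ x → x ∈ Γ'
⊆⊃∷-Is≼ s i p with s i
⊆⊃∷-Is≼ s i () | here refl
... | there j = j

prefs-⊆⊃∷ : ∀ {A B Γ Γ'} → Γ ⊆ (A ⊃ B) ∷ Γ' → prefs Γ ⊆ prefs Γ'
prefs-⊆⊃∷ {Γ = Γ} {Γ'} s i with ∈-prefs⁻ Γ i
... | j , p = ∈-prefs⁺ Γ' (⊆⊃∷-Is≼ s j p) p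

Σ≼-⊆⊃∷ : ∀ {A B Γ Γ'} Σ → Γ ⊆ (A ⊃ B) ∷ Γ' → Σ≼ Σ ⊆ Γ → Σ≼ Σ ⊆ Γ'
Σ≼-⊆⊃∷ Σ s σ i = ⊆⊃∷-Is≼ s (σ i) (∈-Σ≼⇒Is≼ Σ i)

⊃L-inv : ∀ {S n Γ Δ Γ' A B} → HDer S n Γ Δ → Γ ⊆ (A ⊃ B) ∷ Γ' →
       HDer S n Γ' (A ∷ Δ) × HDer S n (B ∷ Γ') Δ
⊃L-inv (init i j) s = init (⊆∷-≢ s i (λ ())) (there j) , init (there (⊆∷-≢ s i (λ ()))) j
⊃L-inv (botL i) s = botL (⊆∷-≢ s i (λ ())) , botL (there (⊆∷-≢ s i (λ ())))
⊃L-inv {n = suc n} {A = A} {B} (impL {A = A'} {B'} i d e) s with (A' ⊃ B') ≟ (A ⊃ B)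
... | yes refl =
  let d1 , _ = ⊃L-inv d s
      _ , e2 = ⊃L-inv e (⊆-trans (∷⁺ʳ _ s) swap⊆)
  in raise (weaken d1 ⊆-refl dup⊆) , raise (weaken e2 dup⊆ ⊆-refl)
... | no ne =
  let i' = ⊆∷-≢ s i ne
      d1 , d2 = ⊃L-inv d s
      e1 , e2 = ⊃L-inv e (⊆-trans (∷⁺ʳ _ s) swap⊆)
  in impL i' (weaken d1 ⊆-refl swap⊆) e1 , impL (there i') d2 (weaken e2 swap⊆ ⊆-refl)
⊃L-inv {n = suc n} (impR i d) s =
  let d1 , d2 = ⊃L-inv d (⊆-trans (∷⁺ʳ _ s) swap⊆)
  in impR (there i) (weaken d1 ⊆-refl swap⊆) , impR i (weaken d2 swap⊆ ⊆-refl)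
⊃L-inv {n = suc n} (cp h {Σ = Σ} i σ ch d) s = cp h (there i) (Σ≼-⊆⊃∷ Σ s σ) ch d , cp h i (⊆-trans (Σ≼-⊆⊃∷ Σ s σ) there) ch d
⊃L-inv {n = suc n} (nr h {Σ = Σ} l σ ch d) s = nr h l (Σ≼-⊆⊃∷ Σ s σ) ch d , nr h l (⊆-trans (Σ≼-⊆⊃∷ Σ s σ) there) ch d
⊃L-inv {n = suc n} {A = A} (tr h {Σ = Σ} σ ch d) s =
  let d1 , d2 = ⊃L-inv d s
  in tr h (Σ≼-⊆⊃∷ Σ s σ) ch (weaken d1 ⊆-refl (∈-∷⁺ʳ (∈-++⁺ʳ (Ds Σ) (here refl)) (++⊆ ∈-++⁺ˡ (⊆-trans there (∈-++⁺ʳ (Ds Σ)))))) ,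
     tr h (⊆-trans (Σ≼-⊆⊃∷ Σ s σ) there) ch d2
⊃L-inv {n = suc n} {A = A} (wn h {Σ = Σ} i σ ch d) s =
  let d1 , d2 = ⊃L-inv d s
  in wn h (there i) (Σ≼-⊆⊃∷ Σ s σ) ch (weaken d1 ⊆-refl (⊆-trans swap⊆ (∷⁺ʳ _ (∈-∷⁺ʳ (∈-++⁺ʳ (Ds Σ) (here refl)) (++⊆ ∈-++⁺ˡ (⊆-trans there (∈-++⁺ʳ (Ds Σ)))))))) ,
     wn h i (⊆-trans (Σ≼-⊆⊃∷ Σ s σ) there) ch d2
⊃L-inv {n = suc n} (w0 h i d) s =
  let d1 , d2 = ⊃L-inv d s
  in w0 h (there i) (weaken d1 ⊆-refl swap⊆) , w0 h i d2
⊃L-inv {n = suc n} (c0 h i d e) s =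
  let d1 , d2 = ⊃L-inv d (⊆-trans (∷⁺ʳ _ s) swap⊆)
      e1 , e2 = ⊃L-inv e s
  in c0 h (⊆⊃∷-Is≼ s i tt) d1 (weaken e1 ⊆-refl swap⊆) , c0 h (there (⊆⊃∷-Is≼ s i tt)) (weaken d2 swap⊆ ⊆-refl) e2
⊃L-inv {n = suc n} {Γ} {Δ} {Γ'} {A} {B} (ar h {Σ = Σ} i σ ch d) s =
  ar-prefs⊆ Γ Δ h (there i) (Σ≼-⊆⊃∷ Σ s σ) (prefs-⊆⊃∷ s) (prefs-∷ A Δ) ch d ,
  ar-prefs⊆ Γ Δ h i (⊆-trans (Σ≼-⊆⊃∷ Σ s σ) there) (⊆-trans (prefs-⊆⊃∷ s) (prefs-∷ B Γ')) ⊆-refl ch d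
⊃L-inv {n = suc n} {Γ} {Δ} {Γ'} {A} {B} (nar h {Σ = Σ} l σ ch d) s =
  nar-prefs⊆ Γ Δ h l (Σ≼-⊆⊃∷ Σ s σ) (prefs-⊆⊃∷ s) (prefs-∷ A Δ) ch d ,
  nar-prefs⊆ Γ Δ h l (⊆-trans (Σ≼-⊆⊃∷ Σ s σ) there) (⊆-trans (prefs-⊆⊃∷ s) (prefs-∷ B Γ')) ⊆-refl ch d

⊃R-inv : ∀ {S n Γ Δ Δ' A B} → HDer S n Γ Δ → Δ ⊆ (A ⊃ B) ∷ Δ' → HDer S n (A ∷ Γ) (B ∷ Δ')
⊃R-inv (init i j) s = init (there i) (there (⊆∷-≢ s j (λ ())))
⊃R-inv (botL i) s = botL (there i)
⊃R-inv {n = suc n} (impL i d e) s =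
  impL (there i) (weaken (⊃R-inv d (⊆-trans (∷⁺ʳ _ s) swap⊆)) ⊆-refl swap⊆) (weaken (⊃R-inv e s) swap⊆ ⊆-refl)
⊃R-inv {n = suc n} {A = A} {B} (impR {A = A'} {B'} i d) s with (A' ⊃ B') ≟ (A ⊃ B)
... | yes refl = raise (weaken (⊃R-inv d (⊆-trans (∷⁺ʳ _ s) swap⊆)) dup⊆ dup⊆)
... | no ne = impR (there (⊆∷-≢ s i ne)) (weaken (⊃R-inv d (⊆-trans (∷⁺ʳ _ s) swap⊆)) swap⊆ swap⊆)
⊃R-inv {n = suc n} (cp h i σ ch d) s = cp h (there (⊆⊃∷-Is≼ s i tt)) (⊆-trans σ there) ch d
⊃R-inv {n = suc n} (nr h l σ ch d) s = nr h l (⊆-trans σ there) ch d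
⊃R-inv {n = suc n} (tr h {Σ = Σ} σ ch d) s =
  tr h (⊆-trans σ there) ch (weaken (⊃R-inv d (++⊆ (⊆-trans ∈-++⁺ˡ there) (⊆-trans s (∷⁺ʳ _ (∈-++⁺ʳ (Ds Σ)))))) ⊆-refl
     (∈-∷⁺ʳ (∈-++⁺ʳ (Ds Σ) (here refl)) (++⊆ ∈-++⁺ˡ (⊆-trans there (∈-++⁺ʳ (Ds Σ))))))
⊃R-inv {n = suc n} (wn h {Σ = Σ} i σ ch d) s =
  wn h (there (⊆⊃∷-Is≼ s i tt)) (⊆-trans σ there) ch
     (weaken (⊃R-inv d (∈-∷⁺ʳ (there (here refl)) (++⊆ (⊆-trans ∈-++⁺ˡ (λ j → there (there j))) (⊆-trans s (∷⁺ʳ _ (λ j → there (∈-++⁺ʳ (Ds Σ) j))))))) ⊆-refl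
       (∈-∷⁺ʳ (there (∈-++⁺ʳ (Ds Σ) (here refl))) (∈-∷⁺ʳ (here refl) (++⊆ (λ j → there (∈-++⁺ˡ j)) (λ j → there (∈-++⁺ʳ (Ds Σ) (there j)))))))
⊃R-inv {n = suc n} (w0 h i d) s = w0 h (there (⊆⊃∷-Is≼ s i tt)) (weaken (⊃R-inv d (⊆-trans (∷⁺ʳ _ s) swap⊆)) ⊆-refl swap⊆)
⊃R-inv {n = suc n} (c0 h i d e) s = c0 h (there i) (weaken (⊃R-inv d s) swap⊆ ⊆-refl) (weaken (⊃R-inv e (⊆-trans (∷⁺ʳ _ s) swap⊆)) ⊆-refl swap⊆)
⊃R-inv {n = suc n} {Γ} {Δ} {Δ'} {A} {B} (ar h {Σ = Σ} i σ ch d) s =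
  ar-prefs⊆ Γ Δ h (there (⊆⊃∷-Is≼ s i tt)) (⊆-trans σ there) (prefs-∷ A Γ) (⊆-trans (prefs-⊆⊃∷ s) (prefs-∷ B Δ')) ch d
⊃R-inv {n = suc n} {Γ} {Δ} {Δ'} {A} {B} (nar h {Σ = Σ} l σ ch d) s =
  nar-prefs⊆ Γ Δ h l (⊆-trans σ there) (prefs-∷ A Γ) (⊆-trans (prefs-⊆⊃∷ s) (prefs-∷ B Δ')) ch d

-- From set-based to multiset derivations

∈⇒↭∷ : ∀ {A : Set} {x : A} {ys} → x ∈ ys → Σ[ zs ∈ List A ] (ys ↭ x ∷ zs)
∈⇒↭∷ i with ys , zs , refl ← ∈-∃++ i = ys ++ zs , shift _ ys zs

data Distinct : List Fm → Set where
  []  : Distinct []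
  _∷_ : ∀ {x xs} → x ∉ xs → Distinct xs → Distinct (x ∷ xs)

⊆⇒↭++ : ∀ {xs ys} → Distinct xs → xs ⊆ ys → Σ[ zs ∈ List Fm ] (ys ↭ zs ++ xs)
⊆⇒↭++ {[]} {ys} [] s = ys , ↭-sym (↭-reflexive (++-identityʳ ys))
⊆⇒↭++ {x ∷ xs} {ys} (nx ∷ dx) s with ∈⇒↭∷ (s (here refl))
... | ys' , p with ⊆⇒↭++ dx (λ {z} j → ⊆∷-≢ (⊆-trans (λ k → s (there k)) (⊆-reflexive-↭ p)) j (λ { refl → nx j }))
... | zs , q = zs , ↭-trans p (↭-trans (↭-prep x q) (↭-sym (shift x zs xs)))

dedup : List Fm → List (Fm × Fm) → List (Fm × Fm)
dedup seen [] = []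
dedup seen ((C , D) ∷ Σ) with (C ≼ D) ∈? seen
... | yes _ = dedup seen Σ
... | no _ = (C , D) ∷ dedup ((C ≼ D) ∷ seen) Σ

dedup-fresh : ∀ seen Σ {x} → x ∈ Σ≼ (dedup seen Σ) → x ∉ seen
dedup-fresh seen [] ()
dedup-fresh seen ((C , D) ∷ Σ) i with (C ≼ D) ∈? seen
... | yes _ = dedup-fresh seen Σ i
dedup-fresh seen ((C , D) ∷ Σ) (here refl) | no n = n
dedup-fresh seen ((C , D) ∷ Σ) (there i) | no n = λ j → dedup-fresh ((C ≼ D) ∷ seen) Σ i (there j)

dedup-distinct : ∀ seen Σ → Distinct (Σ≼ (dedup seen Σ))
dedup-distinct seen [] = []
dedup-distinct seen ((C , D) ∷ Σ) with (C ≼ D) ∈? seen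
... | yes _ = dedup-distinct seen Σ
... | no _ = (λ i → dedup-fresh ((C ≼ D) ∷ seen) Σ i (here refl)) ∷ dedup-distinct ((C ≼ D) ∷ seen) Σ

dedup-⊆ : ∀ seen Σ → Σ≼ (dedup seen Σ) ⊆ Σ≼ Σ
dedup-⊆ seen [] ()
dedup-⊆ seen ((C , D) ∷ Σ) i with (C ≼ D) ∈? seen
... | yes _ = there (dedup-⊆ seen Σ i)
dedup-⊆ seen ((C , D) ∷ Σ) (here e) | no _ = here e
dedup-⊆ seen ((C , D) ∷ Σ) (there i) | no _ = there (dedup-⊆ ((C ≼ D) ∷ seen) Σ i)

Ds-dedup : ∀ seen Σ {x} → x ∈ Ds Σ → x ∈ Ds (dedup seen Σ) ⊎ Σ[ C ∈ Fm ] ((C ≼ x) ∈ seen)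
Ds-dedup seen ((C , D) ∷ Σ) i with (C ≼ D) ∈? seen
Ds-dedup seen ((C , D) ∷ Σ) (here refl) | yes j = inj₂ (C , j)
Ds-dedup seen ((C , D) ∷ Σ) (there i) | yes j = Ds-dedup seen Σ i
Ds-dedup seen ((C , D) ∷ Σ) (here refl) | no _ = inj₁ (here refl)
Ds-dedup seen ((C , D) ∷ Σ) (there i) | no _ with Ds-dedup ((C ≼ D) ∷ seen) Σ i
... | inj₁ k = inj₁ (there k)
... | inj₂ (C' , here e) = inj₁ (here (proj₂ (≼-injective e)))
... | inj₂ (C' , there k) = inj₂ (C' , k)

Ds⊆Ds-dedup : ∀ Σ → Ds Σ ⊆ Ds (dedup [] Σ)
Ds⊆Ds-dedup Σ i with Ds-dedup [] Σ i
... | inj₁ k = k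
... | inj₂ (_ , ())

Monotone : (Fm → List Fm → Set) → Set
Monotone Q = ∀ {C acc acc'} → acc ⊆ acc' → Q C acc → Q C acc'

dedup-chain : ∀ {Q} → Monotone Q → ∀ seen {Σ acc acc'} → Chain Q Σ acc → acc ⊆ acc' →
  (∀ {C D} → (C ≼ D) ∈ seen → D ∈ acc') → Chain Q (dedup seen Σ) acc'
dedup-chain qm seen [] u c = []
dedup-chain qm seen {(C , D) ∷ Σ} (q ∷ ch) u c with (C ≼ D) ∈? seen
... | yes j = dedup-chain qm seen ch (∈-∷⁺ʳ (c j) u) c
... | no _ = qm u q ∷ dedup-chain qm ((C ≼ D) ∷ seen) ch (∷⁺ʳ _ u) λ { (here e) → here (proj₂ (≼-injective e)) ; (there k) → there (c k) }

chain-lookup : ∀ {Q} → Monotone Q → ∀ {Σ acc} → Chain Q Σ acc → (i : Fin (length Σ)) → Q (Cat Σ i) (Dbefore Σ i ++ acc)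
chain-lookup qm (q ∷ ch) fzero = q
chain-lookup qm {(C , D) ∷ Σ} {acc} (q ∷ ch) (fsuc i) =
  qm (++⊆ (λ k → there (∈-++⁺ˡ k)) (∈-∷⁺ʳ (here refl) (λ k → there (∈-++⁺ʳ (take (toℕ i) (Ds Σ)) k)))) (chain-lookup qm ch i)

dedup-premise : ∀ {Q} → Monotone Q → ∀ {Σ} → Chain Q Σ [] →
  (k : Fin (length (dedup [] Σ))) → Q (Cat (dedup [] Σ) k) (Dbefore (dedup [] Σ) k ++ [])
dedup-premise qm ch = chain-lookup qm (dedup-chain qm [] ch ⊆-refl (λ ()))

Σ≼-dedup-↭ : ∀ Σ {Γ} → Σ≼ Σ ⊆ Γ → Σ[ Γ0 ∈ List Fm ] (Γ ↭ Γ0 ++ Σ≼ (dedup [] Σ))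
Σ≼-dedup-↭ Σ σ = ⊆⇒↭++ (dedup-distinct [] Σ) (⊆-trans (dedup-⊆ [] Σ) σ)

prefs-⊆∷ : ∀ {X Γ Γ0} → Γ ⊆ X ∷ Γ0 → prefs Γ ⊆ X ∷ prefs Γ0
prefs-⊆∷ {Γ = Γ} {Γ0} s i with ∈-prefs⁻ Γ i
... | j , p with s j
... | here e = here e
... | there k = there (∈-prefs⁺ Γ0 k p)

prefs-⊆++ : ∀ {Γ Γ0} Y → Γ ⊆ Γ0 ++ Y → prefs Γ ⊆ prefs Γ0 ++ Y
prefs-⊆++ {Γ} {Γ0} Y s i with ∈-prefs⁻ Γ i
... | j , p with ∈-++⁻ Γ0 (s j)
... | inj₁ k = ∈-++⁺ˡ (∈-prefs⁺ Γ0 k p)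
... | inj₂ k = ∈-++⁺ʳ (prefs Γ0) k

dedup-nonempty : ∀ {C D} Σ → 0 < length (dedup [] ((C , D) ∷ Σ))
dedup-nonempty Σ = s≤s z≤n

toSequent : ∀ {S n Γ Δ Γ' Δ'} → HDer S n Γ Δ → Γ ⊆ Γ' → Δ ⊆ Δ' → S ⊢ Γ' ⇒ Δ'
toSequent (init {p = p} i j) s t with ∈⇒↭∷ (s i) | ∈⇒↭∷ (t j)
... | Γ0 , pΓ | Δ0 , pΔ = perm (↭-sym pΓ) (↭-sym pΔ) (_⊢_⇒_.init Γ0 Δ0 p)
toSequent (botL i) s t with ∈⇒↭∷ (s i)
... | Γ0 , pΓ = perm (↭-sym pΓ) ↭-refl (_⊢_⇒_.botL Γ0 _)
toSequent {n = suc n} (impL i d e) s t with ∈⇒↭∷ (s i)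
... | Γ0 , pΓ =
  let s' = ⊆-trans s (⊆-reflexive-↭ pΓ)
      d1 , _ = ⊃L-inv d s'
      _ , e2 = ⊃L-inv e (⊆-trans (∷⁺ʳ _ s') swap⊆)
  in perm (↭-sym pΓ) ↭-refl (_⊢_⇒_.impL (toSequent d1 ⊆-refl (∈-∷⁺ʳ (here refl) (∷⁺ʳ _ t))) (toSequent e2 dup⊆ t))
toSequent {n = suc n} (impR i d) s t with ∈⇒↭∷ (t i)
... | Δ0 , pΔ =
  let t' = ⊆-trans t (⊆-reflexive-↭ pΔ)
  in perm ↭-refl (↭-sym pΔ) (_⊢_⇒_.impR (toSequent (⊃R-inv d (⊆-trans (∷⁺ʳ _ t') swap⊆)) (∈-∷⁺ʳ (here refl) (∷⁺ʳ _ s)) dup⊆))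
toSequent {S} {n = suc n} (cp h {A = A} {B} {Σ} i σ ch d) s t with ∈⇒↭∷ (t i) | Σ≼-dedup-↭ Σ (⊆-trans σ s)
... | Δ0 , pΔ | Γ0 , pΓ = perm (↭-sym pΓ) (↭-sym pΔ) (CP h Γ0 Δ0 A B (dedup [] Σ) prem (toSequent d ⊆-refl (∷⁺ʳ _ (Ds⊆Ds-dedup Σ))))
  where
  qm : Monotone (λ C acc → HDer S n (C ∷ []) (A ∷ acc))
  qm u q = weaken q ⊆-refl (∷⁺ʳ _ u)
  prem : (k : Fin (length (dedup [] Σ))) → S ⊢ Cat (dedup [] Σ) k ∷ [] ⇒ A ∷ Dbefore (dedup [] Σ) k
  prem k = toSequent (dedup-premise qm ch k) ⊆-refl (∷⁺ʳ _ (++⊆ ⊆-refl λ ()))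
toSequent {S} {n = suc n} (nr h {Σ = []} () σ ch d) s t
toSequent {S} {n = suc n} {Δ' = Δ'} (nr h {Σ = (C , D) ∷ Σ} l σ ch d) s t with Σ≼-dedup-↭ ((C , D) ∷ Σ) (⊆-trans σ s)
... | Γ0 , pΓ = perm (↭-sym pΓ) ↭-refl (Nr h Γ0 Δ' (dedup [] ((C , D) ∷ Σ)) (dedup-nonempty Σ) prem (toSequent d ⊆-refl (Ds⊆Ds-dedup ((C , D) ∷ Σ))))
  where
  qm : Monotone (λ C acc → HDer S n (C ∷ []) acc)
  qm u q = weaken q ⊆-refl u
  prem : (k : Fin (length (dedup [] ((C , D) ∷ Σ)))) → S ⊢ Cat (dedup [] ((C , D) ∷ Σ)) k ∷ [] ⇒ Dbefore (dedup [] ((C , D) ∷ Σ)) k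
  prem k = toSequent (dedup-premise qm ch k) ⊆-refl (++⊆ ⊆-refl λ ())
toSequent {S} {n = suc n} (tr h {Σ = []} σ ch d) s t = toSequent d s t
toSequent {S} {n = suc n} {Δ' = Δ'} (tr h {Σ = (C , D) ∷ Σ} σ ch d) s t with Σ≼-dedup-↭ ((C , D) ∷ Σ) (⊆-trans σ s)
... | Γ0 , pΓ = perm (↭-sym pΓ) ↭-refl (Tr h Γ0 Δ' (dedup [] ((C , D) ∷ Σ)) (dedup-nonempty Σ) prem
                   (toSequent d (⊆-trans s (⊆-reflexive-↭ pΓ)) (++⊆ (⊆-trans (Ds⊆Ds-dedup ((C , D) ∷ Σ)) ∈-++⁺ˡ) (⊆-trans t (∈-++⁺ʳ (Ds (dedup [] ((C , D) ∷ Σ))))))))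
  where
  qm : Monotone (λ C acc → HDer S n (C ∷ []) acc)
  qm u q = weaken q ⊆-refl u
  prem : (k : Fin (length (dedup [] ((C , D) ∷ Σ)))) → S ⊢ Cat (dedup [] ((C , D) ∷ Σ)) k ∷ [] ⇒ Dbefore (dedup [] ((C , D) ∷ Σ)) k
  prem k = toSequent (dedup-premise qm ch k) ⊆-refl (++⊆ ⊆-refl λ ())
toSequent {S} {n = suc n} (wn h {A = A} {B} {Σ} i σ ch d) s t with ∈⇒↭∷ (t i) | Σ≼-dedup-↭ Σ (⊆-trans σ s)
... | Δ0 , pΔ | Γ0 , pΓ = perm (↭-sym pΓ) (↭-sym pΔ) (Wn h Γ0 Δ0 A B (dedup [] Σ) prem
       (toSequent d (⊆-trans s (⊆-reflexive-↭ pΓ)) (∷⁺ʳ _ (++⊆ (⊆-trans (Ds⊆Ds-dedup Σ) (λ k → there (∈-++⁺ˡ k))) (⊆-trans (⊆-trans t (⊆-reflexive-↭ pΔ)) (∈-∷⁺ʳ (here refl) (λ k → there (∈-++⁺ʳ (Ds (dedup [] Σ)) k))))))))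
  where
  qm : Monotone (λ C acc → HDer S n (C ∷ []) (A ∷ acc))
  qm u q = weaken q ⊆-refl (∷⁺ʳ _ u)
  prem : (k : Fin (length (dedup [] Σ))) → S ⊢ Cat (dedup [] Σ) k ∷ [] ⇒ A ∷ Dbefore (dedup [] Σ) k
  prem k = toSequent (dedup-premise qm ch k) ⊆-refl (∷⁺ʳ _ (++⊆ ⊆-refl λ ()))
toSequent {n = suc n} {Γ' = Γ'} (w0 h {A = A} {B} i d) s t with ∈⇒↭∷ (t i)
... | Δ0 , pΔ = perm ↭-refl (↭-sym pΔ) (W0 h Γ' Δ0 A B (toSequent d s (⊆-trans (∷⁺ʳ _ (⊆-trans t (⊆-reflexive-↭ pΔ))) swap⊆)))
toSequent {n = suc n} {Δ' = Δ'} (c0 h {A = A} {B} i d e) s t with ∈⇒↭∷ (s i)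
... | Γ0 , pΓ = perm (↭-sym pΓ) ↭-refl (C0 h Γ0 Δ' A B (toSequent d (⊆-trans (∷⁺ʳ _ (⊆-trans s (⊆-reflexive-↭ pΓ))) swap⊆) t) (toSequent e (⊆-trans s (⊆-reflexive-↭ pΓ)) (∷⁺ʳ _ t)))
toSequent {S} {n = suc n} {Γ} {Δ} (ar h {A = A} {B} {Σ} i σ ch d) s t with ∈⇒↭∷ (t i) | Σ≼-dedup-↭ Σ (⊆-trans σ s)
... | Δ0 , pΔ | Γ0 , pΓ = perm (↭-sym pΓ) (↭-sym pΔ) (Ar h Γ0 Δ0 A B (dedup [] Σ) prem
        (toSequent d (∈-∷⁺ʳ (∈-++⁺ʳ (prefs Γ0) (∈-++⁺ʳ (Σ≼ (dedup [] Σ)) (here refl))) (⊆-trans L (++⊆ {xs = prefs Γ0} ∈-++⁺ˡ (λ j → ∈-++⁺ʳ (prefs Γ0) (∈-++⁺ˡ j)))))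
               (∈-∷⁺ʳ (there (here refl)) (++⊆ (⊆-trans (Ds⊆Ds-dedup Σ) (λ k → there (there (∈-++⁺ˡ k)))) (⊆-trans R (∷⁺ʳ _ (λ k → there (∈-++⁺ʳ (Ds (dedup [] Σ)) k))))))))
  where
  L : prefs Γ ⊆ prefs Γ0 ++ Σ≼ (dedup [] Σ)
  L = prefs-⊆++ (Σ≼ (dedup [] Σ)) (⊆-trans s (⊆-reflexive-↭ pΓ))
  R : prefs Δ ⊆ (A ≼ B) ∷ prefs Δ0
  R = prefs-⊆∷ (⊆-trans t (⊆-reflexive-↭ pΔ))
  qm : Monotone (λ C acc → HDer S n (C ∷ prefs Γ) (A ∷ acc ++ prefs Δ))
  qm u q = weaken q ⊆-refl (∷⁺ʳ _ (++⊆ (⊆-trans u ∈-++⁺ˡ) (∈-++⁺ʳ _)))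
  prem : (k : Fin (length (dedup [] Σ))) → S ⊢ prefs Γ0 ++ Σ≼ (dedup [] Σ) ++ Cat (dedup [] Σ) k ∷ [] ⇒ (A ≼ B) ∷ A ∷ Dbefore (dedup [] Σ) k ++ prefs Δ0
  prem k = toSequent (dedup-premise qm ch k)
               (∈-∷⁺ʳ (∈-++⁺ʳ (prefs Γ0) (∈-++⁺ʳ (Σ≼ (dedup [] Σ)) (here refl))) (⊆-trans L (++⊆ {xs = prefs Γ0} ∈-++⁺ˡ (λ k → ∈-++⁺ʳ (prefs Γ0) (∈-++⁺ˡ k)))))
               (∈-∷⁺ʳ (there (here refl)) (++⊆ {xs = Dbefore (dedup [] Σ) k ++ []} (++⊆ {xs = Dbefore (dedup [] Σ) k} (λ j → there (there (∈-++⁺ˡ j))) λ ()) (⊆-trans R (∷⁺ʳ _ (λ j → there (∈-++⁺ʳ (Dbefore (dedup [] Σ) k) j))))))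
toSequent {S} {n = suc n} (nar h {Σ = []} () σ ch d) s t
toSequent {S} {n = suc n} {Γ} {Δ} {Δ' = Δ'} (nar h {Σ = (C , D) ∷ Σ} l σ ch d) s t with Σ≼-dedup-↭ ((C , D) ∷ Σ) (⊆-trans σ s)
... | Γ0 , pΓ = perm (↭-sym pΓ) ↭-refl (NAr h Γ0 Δ' Σ0 (dedup-nonempty Σ) prem
        (toSequent d L (++⊆ (⊆-trans (Ds⊆Ds-dedup ((C , D) ∷ Σ)) ∈-++⁺ˡ) (⊆-trans (prefs-mono t) (∈-++⁺ʳ (Ds Σ0))))))
  where
  Σ0 : List (Fm × Fm)
  Σ0 = dedup [] ((C , D) ∷ Σ)
  L : prefs Γ ⊆ prefs Γ0 ++ Σ≼ Σ0
  L = prefs-⊆++ (Σ≼ Σ0) (⊆-trans s (⊆-reflexive-↭ pΓ))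
  qm : Monotone (λ C acc → HDer S n (C ∷ prefs Γ) (acc ++ prefs Δ))
  qm u q = weaken q ⊆-refl (++⊆ (⊆-trans u ∈-++⁺ˡ) (∈-++⁺ʳ _))
  prem : (k : Fin (length Σ0)) → S ⊢ prefs Γ0 ++ Σ≼ Σ0 ++ Cat Σ0 k ∷ [] ⇒ Dbefore Σ0 k ++ prefs Δ'
  prem k = toSequent (dedup-premise qm ch k)
               (∈-∷⁺ʳ (∈-++⁺ʳ (prefs Γ0) (∈-++⁺ʳ (Σ≼ Σ0) (here refl))) (⊆-trans L (++⊆ {xs = prefs Γ0} ∈-++⁺ˡ (λ k → ∈-++⁺ʳ (prefs Γ0) (∈-++⁺ˡ k)))))
               (++⊆ {xs = Dbefore Σ0 k ++ []} (++⊆ {xs = Dbefore Σ0 k} ∈-++⁺ˡ λ ()) (⊆-trans (prefs-mono t) (∈-++⁺ʳ (Dbefore Σ0 k))))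

Der : Sys → List Fm → List Fm → Set
Der S Γ Δ = Σ[ n ∈ ℕ ] HDer S n Γ Δ

Der⇒⊢ : ∀ {S Γ Δ} → Der S Γ Δ → S ⊢ Γ ⇒ Δ
Der⇒⊢ (_ , d) = toSequent d ⊆-refl ⊆-refl

weakenᴰ : ∀ {S Γ Δ Γ' Δ'} → Der S Γ Δ → Γ ⊆ Γ' → Δ ⊆ Δ' → Der S Γ' Δ'
weakenᴰ (n , d) s t = n , weaken d s t

chain-common-height : ∀ {S} (F : Fm → List Fm) (G : List Fm → List Fm) {Σ acc} →
  Chain (λ C a → Der S (F C) (G a)) Σ acc →
  Σ[ n ∈ ℕ ] (∀ m → n ≤ m → Chain (λ C a → HDer S m (F C) (G a)) Σ acc)
chain-common-height F G [] = 0 , λ _ _ → []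
chain-common-height F G ((k , d) ∷ ch) with chain-common-height F G ch
... | n , f = k ⊔ n , λ m le → raise≤ (≤-trans (m≤m⊔n k n) le) d ∷ f m (≤-trans (m≤n⊔m k n) le)

impLᴰ : ∀ {S Γ Δ A B} → (A ⊃ B) ∈ Γ → Der S Γ (A ∷ Δ) → Der S (B ∷ Γ) Δ → Der S Γ Δ
impLᴰ i (n , d) (m , e) = suc (n ⊔ m) , impL i (raise≤ (m≤m⊔n n m) d) (raise≤ (m≤n⊔m n m) e)

impRᴰ : ∀ {S Γ Δ A B} → (A ⊃ B) ∈ Δ → Der S (A ∷ Γ) (B ∷ Δ) → Der S Γ Δ
impRᴰ i (n , d) = suc n , impR i d

cpᴰ : ∀ {S Γ Δ A B Σ} → hasCPr S → (A ≼ B) ∈ Δ → Σ≼ Σ ⊆ Γ →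
  Chain (λ C a → Der S (C ∷ []) (A ∷ a)) Σ [] → Der S (B ∷ []) (A ∷ Ds Σ) → Der S Γ Δ
cpᴰ {A = A} h i σ ch (k , d) with chain-common-height (λ C → C ∷ []) (λ a → A ∷ a) ch
... | n , f = suc (n ⊔ k) , cp h i σ (f _ (m≤m⊔n n k)) (raise≤ (m≤n⊔m n k) d)

nrᴰ : ∀ {S Γ Δ Σ} → hasNr S → 0 < length Σ → Σ≼ Σ ⊆ Γ →
  Chain (λ C a → Der S (C ∷ []) a) Σ [] → Der S [] (Ds Σ) → Der S Γ Δ
nrᴰ h l σ ch (k , d) with chain-common-height (λ C → C ∷ []) (λ a → a) ch
... | n , f = suc (n ⊔ k) , nr h l σ (f _ (m≤m⊔n n k)) (raise≤ (m≤n⊔m n k) d)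

trᴰ : ∀ {S Γ Δ Σ} → hasTr S → Σ≼ Σ ⊆ Γ →
  Chain (λ C a → Der S (C ∷ []) a) Σ [] → Der S Γ (Ds Σ ++ Δ) → Der S Γ Δ
trᴰ h σ ch (k , d) with chain-common-height (λ C → C ∷ []) (λ a → a) ch
... | n , f = suc (n ⊔ k) , tr h σ (f _ (m≤m⊔n n k)) (raise≤ (m≤n⊔m n k) d)

wnᴰ : ∀ {S Γ Δ A B Σ} → hasWnr S → (A ≼ B) ∈ Δ → Σ≼ Σ ⊆ Γ →
  Chain (λ C a → Der S (C ∷ []) (A ∷ a)) Σ [] → Der S Γ (A ∷ Ds Σ ++ Δ) → Der S Γ Δ
wnᴰ {A = A} h i σ ch (k , d) with chain-common-height (λ C → C ∷ []) (λ a → A ∷ a) ch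
... | n , f = suc (n ⊔ k) , wn h i σ (f _ (m≤m⊔n n k)) (raise≤ (m≤n⊔m n k) d)

w0ᴰ : ∀ {S Γ Δ A B} → hasW0C0r S → (A ≼ B) ∈ Δ → Der S Γ (A ∷ Δ) → Der S Γ Δ
w0ᴰ h i (n , d) = suc n , w0 h i d

c0ᴰ : ∀ {S Γ Δ A B} → hasW0C0r S → (A ≼ B) ∈ Γ → Der S (A ∷ Γ) Δ → Der S Γ (B ∷ Δ) → Der S Γ Δ
c0ᴰ h i (n , d) (m , e) = suc (n ⊔ m) , c0 h i (raise≤ (m≤m⊔n n m) d) (raise≤ (m≤n⊔m n m) e)

arᴰ : ∀ {S Γ Δ A B Σ} → hasAr S → (A ≼ B) ∈ Δ → Σ≼ Σ ⊆ Γ →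
  Chain (λ C a → Der S (C ∷ prefs Γ) (A ∷ a ++ prefs Δ)) Σ [] →
  Der S (B ∷ prefs Γ) (A ∷ Ds Σ ++ prefs Δ) → Der S Γ Δ
arᴰ {Γ = Γ} {Δ} {A} h i σ ch (k , d) with chain-common-height (λ C → C ∷ prefs Γ) (λ a → A ∷ a ++ prefs Δ) ch
... | n , f = suc (n ⊔ k) , ar h i σ (f _ (m≤m⊔n n k)) (raise≤ (m≤n⊔m n k) d)

narᴰ : ∀ {S Γ Δ Σ} → hasNAr S → 0 < length Σ → Σ≼ Σ ⊆ Γ →
  Chain (λ C a → Der S (C ∷ prefs Γ) (a ++ prefs Δ)) Σ [] →
  Der S (prefs Γ) (Ds Σ ++ prefs Δ) → Der S Γ Δ
narᴰ {Γ = Γ} {Δ} h l σ ch (k , d) with chain-common-height (λ C → C ∷ prefs Γ) (λ a → a ++ prefs Δ) ch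
... | n , f = suc (n ⊔ k) , nar h l σ (f _ (m≤m⊔n n k)) (raise≤ (m≤n⊔m n k) d)

hasCPr⊎hasAr : (S : Sys) → hasCPr S ⊎ hasAr S
hasCPr⊎hasAr N = inj₁ tt
hasCPr⊎hasAr NN = inj₁ tt
hasCPr⊎hasAr NT = inj₁ tt
hasCPr⊎hasAr NW = inj₁ tt
hasCPr⊎hasAr NC = inj₁ tt
hasCPr⊎hasAr NA = inj₂ tt
hasCPr⊎hasAr NNA = inj₂ tt

cp-or-ar : ∀ {S Γ Δ A B Σ} → (A ≼ B) ∈ Δ → Σ≼ Σ ⊆ Γ → Chain (λ C a → Der S (C ∷ []) (A ∷ a)) Σ [] → Der S (B ∷ []) (A ∷ Ds Σ) → Der S Γ Δ
cp-or-ar {S} i σ ch d with hasCPr⊎hasAr S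
... | inj₁ h = cpᴰ h i σ ch d
... | inj₂ h = arᴰ h i σ (chain-map (λ q → weakenᴰ q (∷⁺ʳ _ (λ ())) (∷⁺ʳ _ ∈-++⁺ˡ)) ch) (weakenᴰ d (∷⁺ʳ _ (λ ())) (∷⁺ʳ _ ∈-++⁺ˡ))

identity : ∀ {S Γ Δ} A → A ∈ Γ → A ∈ Δ → Der S Γ Δ
identity (atom p) i j = 0 , init i j
identity bot i j = 0 , botL i
identity (A ⊃ B) i j = impRᴰ j (impLᴰ (there i) (identity A (here refl) (here refl)) (identity B (here refl) (here refl)))
identity (A ≼ B) i j =
  cp-or-ar {Σ = (A , B) ∷ []} j (∈-∷⁺ʳ i λ ()) (identity A (here refl) (here refl) ∷ []) (identity B (here refl) (there (here refl)))

-- Cut admissibility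

Ds-rev++ : List (Fm × Fm) → List Fm → List Fm
Ds-rev++ [] a = a
Ds-rev++ ((C , D) ∷ Σ) a = Ds-rev++ Σ (D ∷ a)

Ds-rev++-⊆ : ∀ Σ {a} → Ds-rev++ Σ a ⊆ Ds Σ ++ a
Ds-rev++-⊆ [] i = i
Ds-rev++-⊆ ((C , D) ∷ Σ) {a} i with ∈-++⁻ (Ds Σ) (Ds-rev++-⊆ Σ i)
... | inj₁ j = there (∈-++⁺ˡ j)
... | inj₂ (here e) = here e
... | inj₂ (there j) = there (∈-++⁺ʳ (Ds Σ) j)

acc⊆Ds-rev++ : ∀ Σ {a} → a ⊆ Ds-rev++ Σ a
acc⊆Ds-rev++ [] i = i
acc⊆Ds-rev++ ((C , D) ∷ Σ) i = acc⊆Ds-rev++ Σ (there i)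

Ds⊆Ds-rev++ : ∀ Σ {a} → Ds Σ ⊆ Ds-rev++ Σ a
Ds⊆Ds-rev++ ((C , D) ∷ Σ) (here e) = acc⊆Ds-rev++ Σ (here e)
Ds⊆Ds-rev++ ((C , D) ∷ Σ) (there i) = Ds⊆Ds-rev++ Σ i

Ds++⁻ : ∀ Σa {Σb} → Ds (Σa ++ Σb) ⊆ Ds Σa ++ Ds Σb
Ds++⁻ [] i = i
Ds++⁻ (_ ∷ Σa) (here e) = here e
Ds++⁻ (_ ∷ Σa) (there i) = there (Ds++⁻ Σa i)

Ds++ˡ : ∀ Σa {Σb} → Ds Σa ⊆ Ds (Σa ++ Σb)
Ds++ˡ (_ ∷ Σa) (here e) = here e
Ds++ˡ (_ ∷ Σa) (there i) = there (Ds++ˡ Σa i)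

Ds++ʳ : ∀ Σa {Σb} → Ds Σb ⊆ Ds (Σa ++ Σb)
Ds++ʳ [] i = i
Ds++ʳ (_ ∷ Σa) i = there (Ds++ʳ Σa i)

Σ≼++⁻ : ∀ Σa {Σb} → Σ≼ (Σa ++ Σb) ⊆ Σ≼ Σa ++ Σ≼ Σb
Σ≼++⁻ [] i = i
Σ≼++⁻ (_ ∷ Σa) (here e) = here e
Σ≼++⁻ (_ ∷ Σa) (there i) = there (Σ≼++⁻ Σa i)

Σ≼++ˡ : ∀ Σa {Σb} → Σ≼ Σa ⊆ Σ≼ (Σa ++ Σb)
Σ≼++ˡ (_ ∷ Σa) (here e) = here e
Σ≼++ˡ (_ ∷ Σa) (there i) = there (Σ≼++ˡ Σa i)

Σ≼++ʳ : ∀ Σa {Σb} → Σ≼ Σb ⊆ Σ≼ (Σa ++ Σb)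
Σ≼++ʳ [] i = i
Σ≼++ʳ (_ ∷ Σa) i = there (Σ≼++ʳ Σa i)

remove : Fm → List (Fm × Fm) → List (Fm × Fm)
remove X [] = []
remove X ((C , D) ∷ Σ) with (C ≼ D) ≟ X
... | yes _ = remove X Σ
... | no _ = (C , D) ∷ remove X Σ

remove-⊆ : ∀ X Σ → Σ≼ (remove X Σ) ⊆ Σ≼ Σ
remove-⊆ X ((C , D) ∷ Σ) i with (C ≼ D) ≟ X
... | yes _ = there (remove-⊆ X Σ i)
remove-⊆ X ((C , D) ∷ Σ) (here e) | no _ = here e
remove-⊆ X ((C , D) ∷ Σ) (there i) | no _ = there (remove-⊆ X Σ i)

remove-∉ : ∀ X Σ → X ∉ Σ≼ (remove X Σ)
remove-∉ X [] ()
remove-∉ X ((C , D) ∷ Σ) i with (C ≼ D) ≟ X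
... | yes _ = remove-∉ X Σ i
remove-∉ X ((C , D) ∷ Σ) (here e) | no ne = ne (sym e)
remove-∉ X ((C , D) ∷ Σ) (there i) | no _ = remove-∉ X Σ i

Ds-remove : ∀ A B Σ → Ds Σ ⊆ B ∷ Ds (remove (A ≼ B) Σ)
Ds-remove A B ((C , D) ∷ Σ) i with (C ≼ D) ≟ (A ≼ B)
Ds-remove A B ((C , D) ∷ Σ) (here refl) | yes e = here (proj₂ (≼-injective e))
Ds-remove A B ((C , D) ∷ Σ) (there i) | yes e = Ds-remove A B Σ i
Ds-remove A B ((C , D) ∷ Σ) (here refl) | no _ = there (here refl)
Ds-remove A B ((C , D) ∷ Σ) (there i) | no _ with Ds-remove A B Σ i
... | here e = here e
... | there j = there (there j)

split-first : ∀ A B Σ → (A ≼ B) ∈ Σ≼ Σ →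
  Σ[ Σa ∈ List (Fm × Fm) ] Σ[ Σb ∈ List (Fm × Fm) ] ((Σ ≡ Σa ++ (A , B) ∷ Σb) × ((A ≼ B) ∉ Σ≼ Σa))
split-first A B ((C , D) ∷ Σ) i with (C ≼ D) ≟ (A ≼ B)
... | yes e with ≼-injective e
... | refl , refl = [] , Σ , refl , (λ ())
split-first A B ((C , D) ∷ Σ) (here e) | no ne = ⊥-elim (ne (sym e))
split-first A B ((C , D) ∷ Σ) (there i) | no ne with split-first A B Σ i
... | Σa , Σb , refl , nn = (C , D) ∷ Σa , Σb , refl , λ { (here e) → ne (sym e) ; (there j) → nn j }

chain-split : ∀ {Q A B} Σa {Σb acc} → Chain Q (Σa ++ (A , B) ∷ Σb) acc →
  Chain Q Σa acc × Q A (Ds-rev++ Σa acc) × Chain Q Σb (B ∷ Ds-rev++ Σa acc)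
chain-split [] (q ∷ ch) = [] , q , ch
chain-split ((C , D) ∷ Σa) (q ∷ ch) with chain-split Σa ch
... | c1 , qa , c2 = q ∷ c1 , qa , c2

chain-++ : ∀ {Q} Σa {Σb acc} → Chain Q Σa acc → Chain Q Σb (Ds-rev++ Σa acc) → Chain Q (Σa ++ Σb) acc
chain-++ [] [] c = c
chain-++ ((C , D) ∷ Σa) (q ∷ c1) c2 = q ∷ chain-++ Σa c1 c2

chain-remove : ∀ {Q Q' : Fm → List Fm → Set} A B (R : List Fm → List Fm → Set) →
  (∀ {D a a'} → R a a' → R (D ∷ a) (D ∷ a')) →
  (∀ {a a'} → R a a' → R (B ∷ a) a') →
  (∀ {C a a'} → R a a' → Q C a → Q' C a') →
  ∀ {Σ acc acc'} → R acc acc' → Chain Q Σ acc → Chain Q' (remove (A ≼ B) Σ) acc'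
chain-remove A B R step skip f r [] = []
chain-remove A B R step skip f {(C , D) ∷ Σ} r (q ∷ ch) with (C ≼ D) ≟ (A ≼ B)
... | yes e with ≼-injective e
... | refl , refl = chain-remove A B R step skip f (skip r) ch
chain-remove A B R step skip f {(C , D) ∷ Σ} r (q ∷ ch) | no _ = f r q ∷ chain-remove A B R step skip f (step r) ch

++-mid⁺ : ∀ R {a a'} M → a ⊆ a' → R ++ a ++ M ⊆ R ++ a' ++ M
++-mid⁺ R M s = ++⊆ {xs = R} ∈-++⁺ˡ (++⊆ (λ i → ∈-++⁺ʳ R (∈-++⁺ˡ (s i))) (λ i → ∈-++⁺ʳ R (∈-++⁺ʳ _ i)))

mid⊆++ : ∀ R {a} M → a ⊆ R ++ a ++ M
mid⊆++ R M i = ∈-++⁺ʳ R (∈-++⁺ˡ i)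

right⊆++ : ∀ R a {M} → M ⊆ R ++ a ++ M
right⊆++ R a i = ∈-++⁺ʳ R (∈-++⁺ʳ a i)

++-mid⁺∷ : ∀ R {a a' B} M → a ⊆ B ∷ a' → R ++ a ++ M ⊆ B ∷ (R ++ a' ++ M)
++-mid⁺∷ R {a} {a'} M s i with ∈-++⁻ R i
... | inj₁ j = there (∈-++⁺ˡ j)
... | inj₂ j with ∈-++⁻ a j
... | inj₂ k = there (right⊆++ R a' k)
... | inj₁ k with s k
... | here e = here e
... | there l = there (mid⊆++ R M l)

-- A principal cut on A ≼ B against a rule over Σ₂ = Σa ++ (A , B) ∷ Σb:
-- the premise for A is cut against the left premises (cut on A), and each
-- later premise, which may use B, against B ⇒ A, Ds Σ₁ (cuts on B and A).
module Reduction {S : Sys} (A B : Fm)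
  (cutA : ∀ {Γ Δ} → Der S Γ (A ∷ Δ) → Der S (A ∷ Γ) Δ → Der S Γ Δ)
  (cutB : ∀ {Γ Δ} → Der S Γ (B ∷ Δ) → Der S (B ∷ Γ) Δ → Der S Γ Δ)
  (K R M DA : List Fm) (pA : Der S (A ∷ K) (R ++ DA ++ M)) where

  Premise : Fm → List Fm → Set
  Premise C a = Der S (C ∷ K) (R ++ a ++ M)

  cut-A : ∀ {K' L'} → Der S K' (A ∷ L') → K ⊆ K' → R ++ DA ++ M ⊆ L' → Der S K' L'
  cut-A x s t = cutA x (weakenᴰ pA (∷⁺ʳ _ s) t)

  module WithBPremise (K1 M1 Ds1 : List Fm) (q1 : Der S (B ∷ K1) (A ∷ Ds1 ++ M1)) where

    cut-BA : ∀ {K' L'} → Der S K' (B ∷ L') → K1 ⊆ K' → Ds1 ++ M1 ⊆ L' → K ⊆ K' → R ++ DA ++ M ⊆ L' → Der S K' L'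
    cut-BA x s1 t1 s t = cut-A (cutB (weakenᴰ x ⊆-refl (∷⁺ʳ _ there)) (weakenᴰ q1 (∷⁺ʳ _ s1) (∷⁺ʳ _ t1))) s t

    cut-BA-chain : K1 ⊆ K → M1 ⊆ M → ∀ {Σ acc acc'} → acc ⊆ B ∷ acc' → DA ⊆ acc' → Ds1 ⊆ acc' →
      Chain Premise Σ acc → Chain Premise (remove (A ≼ B) Σ) acc'
    cut-BA-chain k1 m1 u v w ch = chain-remove A B Rel (λ (u , v , w) → ∈-∷⁺ʳ (there (here refl)) (⊆-trans u (∷⁺ʳ _ there)) , ⊆-trans v there , ⊆-trans w there) (λ (u , v , w) → ∈-∷⁺ʳ (here refl) u , v , w)
      (λ {C} {a} {a'} (u , v , w) q → cut-BA (weakenᴰ q ⊆-refl (++-mid⁺∷ R M u)) (⊆-trans k1 there) (++⊆ (⊆-trans w (mid⊆++ R M)) (⊆-trans m1 (right⊆++ R a'))) there (++-mid⁺ R M v))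
      (u , v , w) ch
      where
      Rel : List Fm → List Fm → Set
      Rel a a' = (a ⊆ B ∷ a') × (DA ⊆ a') × (Ds1 ⊆ a')

  cut-A-chain : ∀ (K1 M1 : List Fm) → K1 ⊆ K → M1 ⊆ M → ∀ {Σ acc acc'} → acc ⊆ acc' → DA ⊆ acc' →
    Chain (λ C a → Der S (C ∷ K1) (A ∷ a ++ M1)) Σ acc → Chain Premise Σ acc'
  cut-A-chain K1 M1 k1 m1 u v ch = chain-mapWith Rel (λ (u , v) → ∷⁺ʳ _ u , λ i → there (v i))
     (λ {C} {a} {a'} (u , v) q → cut-A (weakenᴰ q (∷⁺ʳ _ k1) (∷⁺ʳ _ (++⊆ (⊆-trans u (mid⊆++ R M)) (⊆-trans m1 (right⊆++ R a'))))) there (++-mid⁺ R M v))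
     (u , v) ch
    where
    Rel : List Fm → List Fm → Set
    Rel a a' = (a ⊆ a') × (DA ⊆ a')

Premise′ : Sys → List Fm → List Fm → List Fm → Fm → List Fm → Set
Premise′ S K R M C a = Der S (C ∷ K) (R ++ a ++ M)

Cut : Sys → Fm → Set
Cut S A = ∀ {Γ Δ} → Der S Γ (A ∷ Δ) → Der S (A ∷ Γ) Δ → Der S Γ Δ

CutsBA : Sys → (A B : Fm) (K R M K1 M1 Σ' : List Fm) → Set
CutsBA S A B K R M K1 M1 Ds' = ∀ {K' L'} → Der S K' (B ∷ L') → K1 ⊆ K' → K ⊆ K' → Ds' ⊆ L' → R ⊆ L' → M ⊆ L' → M1 ⊆ L' → Der S K' L'

CutsA : Sys → (A : Fm) (K R M Ds' : List Fm) → Set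
CutsA S A K R M Ds' = ∀ {K' L'} → Der S K' (A ∷ L') → K ⊆ K' → Ds' ⊆ L' → R ⊆ L' → M ⊆ L' → Der S K' L'

++³⊆ : ∀ {R a M L} → R ⊆ L → a ⊆ L → M ⊆ L → R ++ a ++ M ⊆ L
++³⊆ {R} {a} r s t = ++⊆ {xs = R} r (++⊆ {xs = a} s t)

splice-cp : ∀ {S Γ} A B → Cut S A → Cut S B → ∀ K R M K1 M1 → K1 ⊆ K → M1 ⊆ M →
  ∀ Σ2 → Σ≼ Σ2 ⊆ (A ≼ B) ∷ Γ → (A ≼ B) ∈ Σ≼ Σ2 → Chain (Premise′ S K R M) Σ2 [] →
  ∀ Σ1 → Σ≼ Σ1 ⊆ Γ → Chain (λ C a → Der S (C ∷ K1) (A ∷ a ++ M1)) Σ1 [] → Der S (B ∷ K1) (A ∷ Ds Σ1 ++ M1) →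
  Σ[ Σ' ∈ List (Fm × Fm) ] (Σ≼ Σ' ⊆ Γ × Chain (Premise′ S K R M) Σ' [] × (Ds Σ2 ⊆ B ∷ Ds Σ') × CutsBA S A B K R M K1 M1 (Ds Σ'))
splice-cp {S} {Γ} A B cutA cutB K R M K1 M1 k1 m1 Σ2 σ2 inX ch2 Σ1 σ1 ch1 q1 with split-first A B Σ2 inX
... | Σa , Σb , refl , nX with chain-split Σa ch2
... | chA , pA , chb = Σ' , σ' , chain-++ Σa chA (chain-++ Σ1 c1 cb) , dsB , elim
  where
  DA : List Fm
  DA = Ds-rev++ Σa []
  open Reduction A B cutA cutB K R M DA pA
  open WithBPremise K1 M1 (Ds Σ1) q1
  c1 : Chain Premise Σ1 DA
  c1 = cut-A-chain K1 M1 k1 m1 {Σ1} {[]} {DA} (λ ()) ⊆-refl ch1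
  cb : Chain Premise (remove (A ≼ B) Σb) (Ds-rev++ Σ1 DA)
  cb = cut-BA-chain k1 m1 {Σb} {B ∷ DA} {Ds-rev++ Σ1 DA} (∷⁺ʳ _ (acc⊆Ds-rev++ Σ1)) (acc⊆Ds-rev++ Σ1) (Ds⊆Ds-rev++ Σ1) chb
  Σ' : List (Fm × Fm)
  Σ' = Σa ++ Σ1 ++ remove (A ≼ B) Σb
  σ'-cases : ∀ {x} → x ∈ Σ≼ Σa ++ Σ≼ (Σ1 ++ remove (A ≼ B) Σb) → x ∈ Γ
  σ'-cases {x} i with ∈-++⁻ (Σ≼ Σa) i
  ... | inj₁ j = ⊆∷∧∉⇒⊆ (λ k → σ2 (Σ≼++ˡ Σa k)) nX j
  ... | inj₂ j with ∈-++⁻ (Σ≼ Σ1) (Σ≼++⁻ Σ1 j)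
  ... | inj₁ k = σ1 k
  ... | inj₂ k = ⊆∷∧∉⇒⊆ (λ l → σ2 (Σ≼++ʳ Σa (there (remove-⊆ (A ≼ B) Σb l)))) (remove-∉ (A ≼ B) Σb) k
  σ' : Σ≼ Σ' ⊆ Γ
  σ' i = σ'-cases (Σ≼++⁻ Σa i)
  dsA : DA ⊆ Ds Σ'
  dsA i = Ds++ˡ Σa (++⊆ {xs = Ds Σa} ⊆-refl (λ ()) (Ds-rev++-⊆ Σa i))
  ds1 : Ds Σ1 ⊆ Ds Σ'
  ds1 i = Ds++ʳ Σa (Ds++ˡ Σ1 i)
  dsB : Ds (Σa ++ (A , B) ∷ Σb) ⊆ B ∷ Ds Σ'
  dsB i with ∈-++⁻ (Ds Σa) (Ds++⁻ Σa i)
  ... | inj₁ j = there (Ds++ˡ Σa j)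
  ... | inj₂ (here e) = here e
  ... | inj₂ (there j) with Ds-remove A B Σb j
  ... | here e = here e
  ... | there k = there (Ds++ʳ Σa (Ds++ʳ Σ1 k))
  elim : CutsBA S A B K R M K1 M1 (Ds Σ')
  elim x s1 s ds r mm m1' = cut-BA x s1 (++⊆ (⊆-trans ds1 ds) m1') s (++³⊆ {R} r (⊆-trans dsA ds) mm)

splice-chain : ∀ {S Γ} A B → Cut S A → ∀ K R M K1 M1 → K1 ⊆ K → M1 ⊆ M →
  ∀ Σ2 → Σ≼ Σ2 ⊆ (A ≼ B) ∷ Γ → (A ≼ B) ∈ Σ≼ Σ2 → Chain (Premise′ S K R M) Σ2 [] →
  ∀ Σ1 → Σ≼ Σ1 ⊆ Γ → Chain (λ C a → Der S (C ∷ K1) (A ∷ a ++ M1)) Σ1 [] →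
  Σ[ Σ' ∈ List (Fm × Fm) ] (Σ≼ Σ' ⊆ Γ × Chain (Premise′ S K R M) Σ' [] × (Ds Σ1 ⊆ Ds Σ') × CutsA S A K R M (Ds Σ'))
splice-chain {S} {Γ} A B cutA K R M K1 M1 k1 m1 Σ2 σ2 inX ch2 Σ1 σ1 ch1 with split-first A B Σ2 inX
... | Σa , Σb , refl , nX with chain-split Σa ch2
... | chA , pA , chb = Σ' , σ' , chain-++ Σa chA c1 , ds1 , elim
  where
  DA : List Fm
  DA = Ds-rev++ Σa []
  open Reduction A A cutA cutA K R M DA pA
  c1 : Chain Premise Σ1 DA
  c1 = cut-A-chain K1 M1 k1 m1 {Σ1} {[]} {DA} (λ ()) ⊆-refl ch1
  Σ' : List (Fm × Fm)
  Σ' = Σa ++ Σ1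
  σ' : Σ≼ Σ' ⊆ Γ
  σ' i with ∈-++⁻ (Σ≼ Σa) (Σ≼++⁻ Σa i)
  ... | inj₁ j = ⊆∷∧∉⇒⊆ (λ k → σ2 (Σ≼++ˡ Σa k)) nX j
  ... | inj₂ k = σ1 k
  dsA : DA ⊆ Ds Σ'
  dsA i = Ds++ˡ Σa (++⊆ {xs = Ds Σa} ⊆-refl (λ ()) (Ds-rev++-⊆ Σa i))
  ds1 : Ds Σ1 ⊆ Ds Σ'
  ds1 i = Ds++ʳ Σa i
  elim : CutsA S A K R M (Ds Σ')
  elim x s ds r mm = cut-A x s (++³⊆ {R} r (⊆-trans dsA ds) mm)

discharge-c0 : ∀ {S Γ Δ} {Q : Fm → List Fm → Set} → hasW0C0r S → (∀ {C a} → Q C a → Der S (C ∷ Γ) (a ++ Δ)) →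
  ∀ {Σ acc} → Σ≼ Σ ⊆ Γ → Chain Q Σ acc → Der S Γ (Ds Σ ++ acc ++ Δ) → Der S Γ (acc ++ Δ)
discharge-c0 h f σ [] d = d
discharge-c0 {Δ = Δ} h f {(C , D) ∷ Σ} {acc} σ (q ∷ ch) d =
  c0ᴰ h (σ (here refl)) (f q) (discharge-c0 h f (λ i → σ (there i)) ch (weakenᴰ d ⊆-refl (∈-∷⁺ʳ (∈-++⁺ʳ (Ds Σ) (here refl)) (++⊆ {xs = Ds Σ} ∈-++⁺ˡ (λ i → ∈-++⁺ʳ (Ds Σ) (there i))))))

¬cp∧ar : ∀ {S} → hasCPr S → hasAr S → ⊥
¬cp∧ar {NA} () _
¬cp∧ar {NNA} () _

¬wn∧ar : ∀ {S} → hasWnr S → hasAr S → ⊥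
¬wn∧ar {NW} _ ()

¬w0∧ar : ∀ {S} → hasW0C0r S → hasAr S → ⊥
¬w0∧ar {NC} _ ()

¬cp∧nar : ∀ {S} → hasCPr S → hasNAr S → ⊥
¬cp∧nar {NNA} () _

¬wn∧nar : ∀ {S} → hasWnr S → hasNAr S → ⊥
¬wn∧nar {NW} _ ()

¬w0∧nar : ∀ {S} → hasW0C0r S → hasNAr S → ⊥
¬w0∧nar {NC} _ ()

¬wn∧nr : ∀ {S} → hasWnr S → hasNr S → ⊥
¬wn∧nr {NW} _ ()

¬w0∧nr : ∀ {S} → hasW0C0r S → hasNr S → ⊥
¬w0∧nr {NC} _ ()

¬ar∧nr : ∀ {S} → hasAr S → hasNr S → ⊥
¬ar∧nr {NA} _ ()
¬ar∧nr {NNA} _ ()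

¬nar∧nr : ∀ {S} → hasNAr S → hasNr S → ⊥
¬nar∧nr {NNA} _ ()

¬w0∧tr : ∀ {S} → hasW0C0r S → hasTr S → ⊥
¬w0∧tr {NC} _ ()

¬ar∧tr : ∀ {S} → hasAr S → hasTr S → ⊥
¬ar∧tr {NA} _ ()
¬ar∧tr {NNA} _ ()

¬nar∧tr : ∀ {S} → hasNAr S → hasTr S → ⊥
¬nar∧tr {NNA} _ ()

¬w0∧wn : ∀ {S} → hasW0C0r S → hasWnr S → ⊥
¬w0∧wn {NC} _ ()

¬ar∧w0 : ∀ {S} → hasAr S → hasW0C0r S → ⊥
¬ar∧w0 {NA} _ ()
¬ar∧w0 {NNA} _ ()

¬nar∧w0 : ∀ {S} → hasNAr S → hasW0C0r S → ⊥
¬nar∧w0 {NNA} _ ()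

¬ar∧wn : ∀ {S} → hasAr S → hasWnr S → ⊥
¬ar∧wn {NA} _ ()
¬ar∧wn {NNA} _ ()

¬nar∧wn : ∀ {S} → hasNAr S → hasWnr S → ⊥
¬nar∧wn {NNA} _ ()

is≼? : (X : Fm) → Dec (Is≼ X)
is≼? (atom _) = no λ ()
is≼? bot = no λ ()
is≼? (_ ⊃ _) = no λ ()
is≼? (_ ≼ _) = yes tt

prefs-∷-¬Is≼ : ∀ {X} Δ → ¬ Is≼ X → prefs (X ∷ Δ) ⊆ prefs Δ
prefs-∷-¬Is≼ {X} Δ np i with ∈-prefs⁻ (X ∷ Δ) i
... | here refl , p = ⊥-elim (np p)
... | there j , p = ∈-prefs⁺ Δ j p

prefs-⊆prefs : ∀ Γ {Γ'} → prefs Γ ⊆ Γ' → prefs Γ ⊆ prefs Γ'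
prefs-⊆prefs Γ {Γ'} s i = ∈-prefs⁺ Γ' (s i) (proj₂ (∈-prefs⁻ Γ i))

prefs-∷⊆ : ∀ {X} Γ → prefs (X ∷ Γ) ⊆ X ∷ prefs Γ
prefs-∷⊆ Γ = prefs-⊆∷ ⊆-refl

data IsArNar {S} : ∀ {n Γ Δ} → HDer S n Γ Δ → Set where
  isAr : ∀ {n Γ Δ A B Σ} h (i : (A ≼ B) ∈ Δ) (σ : Σ≼ Σ ⊆ Γ) ch (d : HDer S n (B ∷ prefs Γ) (A ∷ Ds Σ ++ prefs Δ)) → IsArNar (ar h i σ ch d)
  isNar : ∀ {n Γ Δ Σ} h (l : 0 < length Σ) (σ : Σ≼ Σ ⊆ Γ) ch (d : HDer S n (prefs Γ) (Ds Σ ++ prefs Δ)) → IsArNar {Δ = Δ} (nar h l σ ch d)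

rebox : ∀ {S n Γ Δ Γ* Δ*} (d : HDer S n Γ Δ) → IsArNar d → prefs Γ ⊆ Γ* → prefs Δ ⊆ Δ* → HDer S n Γ* Δ*
rebox {Γ = Γ} {Δ} (ar h i σ ch d) (isAr _ _ _ _ _) s t =
  ar-prefs⊆ Γ Δ h (t (∈-prefs⁺ Δ i tt)) (λ k → s (Σ≼⊆prefs _ Γ σ k)) (prefs-⊆prefs Γ s) (prefs-⊆prefs Δ t) ch d
rebox {Γ = Γ} {Δ} (nar h l σ ch d) (isNar _ _ _ _ _) s t =
  nar-prefs⊆ Γ Δ h l (λ k → s (Σ≼⊆prefs _ Γ σ k)) (prefs-⊆prefs Γ s) (prefs-⊆prefs Δ t) ch d

pad : ∀ {S n C A a} → HDer S n (C ∷ []) (A ∷ a) → Der S (C ∷ []) (A ∷ a ++ [])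
pad {n = n} q = n , weaken q ⊆-refl (∷⁺ʳ _ ∈-++⁺ˡ)

pad₀ : ∀ {S n C a} → HDer S n (C ∷ []) a → Der S (C ∷ []) (a ++ [])
pad₀ {n = n} q = n , weaken q ⊆-refl ∈-++⁺ˡ

unpad : ∀ {S C A a} → Der S (C ∷ []) (A ∷ a ++ []) → Der S (C ∷ []) (A ∷ a)
unpad q = weakenᴰ q ⊆-refl (∷⁺ʳ _ (++⊆ ⊆-refl λ ()))

unpad₀ : ∀ {S C a} → Der S (C ∷ []) (a ++ []) → Der S (C ∷ []) a
unpad₀ q = weakenᴰ q ⊆-refl (++⊆ ⊆-refl λ ())

der : ∀ {S n Γ Δ} → HDer S n Γ Δ → Der S Γ Δ
der {n = n} d = n , d

nr-or-empty : ∀ {S Γ Δ} → hasNr S → ∀ Σ → Σ≼ Σ ⊆ Γ → Chain (λ C a → Der S (C ∷ []) a) Σ [] → Der S [] (Ds Σ) → Der S Γ Δ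
nr-or-empty h [] σ ch d = weakenᴰ d (λ ()) (λ ())
nr-or-empty h (x ∷ Σ) σ ch d = nrᴰ h (s≤s z≤n) σ ch d

nar-or-empty : ∀ {S Γ Δ} → hasNAr S → ∀ Σ → Σ≼ Σ ⊆ Γ → Chain (λ C a → Der S (C ∷ prefs Γ) (a ++ prefs Δ)) Σ [] → Der S (prefs Γ) (Ds Σ ++ prefs Δ) → Der S Γ Δ
nar-or-empty {Γ = Γ} {Δ} h [] σ ch d = weakenᴰ d (prefs⊆ Γ) (prefs⊆ Δ)
nar-or-empty h (x ∷ Σ) σ ch d = narᴰ h (s≤s z≤n) σ ch d

module PrincipalCases {S : Sys} {A B : Fm} (cutA : Cut S A) (cutB : Cut S B) where

  module LeftCP {Γ : List Fm} {n : ℕ} {Σ1 : List (Fm × Fm)} (σ1 : Σ≼ Σ1 ⊆ Γ)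
    (ch1 : Chain (λ C a → HDer S n (C ∷ []) (A ∷ a)) Σ1 []) (q1 : HDer S n (B ∷ []) (A ∷ Ds Σ1)) where

    ch1' : Chain (λ C a → Der S (C ∷ []) (A ∷ a ++ [])) Σ1 []
    ch1' = chain-map pad ch1

    q1' : Der S (B ∷ []) (A ∷ Ds Σ1 ++ [])
    q1' = pad q1

    cpcp : ∀ {Δ E F m Σ2} → hasCPr S → (E ≼ F) ∈ Δ → Σ≼ Σ2 ⊆ (A ≼ B) ∷ Γ → (A ≼ B) ∈ Σ≼ Σ2 →
      Chain (λ C a → HDer S m (C ∷ []) (E ∷ a)) Σ2 [] → HDer S m (F ∷ []) (E ∷ Ds Σ2) → Der S Γ Δ
    cpcp {E = E} {F} {Σ2 = Σ2} h i σ2 inX ch2 q2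
      with splice-cp A B cutA cutB [] (E ∷ []) [] [] [] ⊆-refl ⊆-refl Σ2 σ2 inX (chain-map pad ch2) Σ1 σ1 ch1' q1'
    ... | Σ' , σ' , ch' , dsB , elim =
      cpᴰ h i σ' (chain-map unpad ch')
        (elim (der (weaken q2 ⊆-refl (∈-∷⁺ʳ (there (here refl)) (⊆-trans dsB (∷⁺ʳ _ there))))) (λ ()) (λ ()) there (∈-∷⁺ʳ (here refl) (λ ())) (λ ()) (λ ()))

    cpnr : ∀ {Δ m Σ2} → hasNr S → Σ≼ Σ2 ⊆ (A ≼ B) ∷ Γ → (A ≼ B) ∈ Σ≼ Σ2 →
      Chain (λ C a → HDer S m (C ∷ []) a) Σ2 [] → HDer S m [] (Ds Σ2) → Der S Γ Δ
    cpnr {Σ2 = Σ2} h σ2 inX ch2 q2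
      with splice-cp A B cutA cutB [] [] [] [] [] ⊆-refl ⊆-refl Σ2 σ2 inX (chain-map pad₀ ch2) Σ1 σ1 ch1' q1'
    ... | Σ' , σ' , ch' , dsB , elim =
      nr-or-empty h Σ' σ' (chain-map unpad₀ ch')
        (elim (der (weaken q2 ⊆-refl dsB)) (λ ()) (λ ()) ⊆-refl (λ ()) (λ ()) (λ ()))

    cptr : ∀ {Δ Σ2} → hasTr S → Σ≼ Σ2 ⊆ (A ≼ B) ∷ Γ → (A ≼ B) ∈ Σ≼ Σ2 → ∀ {m} →
      Chain (λ C a → HDer S m (C ∷ []) a) Σ2 [] → Der S Γ (Ds Σ2 ++ Δ) → Der S Γ Δ
    cptr {Δ} {Σ2} h σ2 inX ch2 r2
      with splice-cp A B cutA cutB [] [] [] [] [] ⊆-refl ⊆-refl Σ2 σ2 inX (chain-map pad₀ ch2) Σ1 σ1 ch1' q1'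
    ... | Σ' , σ' , ch' , dsB , elim =
      trᴰ h σ' (chain-map unpad₀ ch')
        (elim (weakenᴰ r2 ⊆-refl (++⊆ (⊆-trans dsB (∷⁺ʳ _ ∈-++⁺ˡ)) (λ j → there (∈-++⁺ʳ (Ds Σ') j)))) (λ ()) (λ ()) ∈-++⁺ˡ (λ ()) (λ ()) (λ ()))

    cpwn : ∀ {Δ E F Σ2} → hasWnr S → (E ≼ F) ∈ Δ → Σ≼ Σ2 ⊆ (A ≼ B) ∷ Γ → (A ≼ B) ∈ Σ≼ Σ2 → ∀ {m} →
      Chain (λ C a → HDer S m (C ∷ []) (E ∷ a)) Σ2 [] → Der S Γ (E ∷ Ds Σ2 ++ Δ) → Der S Γ Δ
    cpwn {Δ} {E} {F} {Σ2} h i σ2 inX ch2 r2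
      with splice-cp A B cutA cutB [] (E ∷ []) [] [] [] ⊆-refl ⊆-refl Σ2 σ2 inX (chain-map pad ch2) Σ1 σ1 ch1' q1'
    ... | Σ' , σ' , ch' , dsB , elim =
      wnᴰ h i σ' (chain-map unpad ch')
        (elim (weakenᴰ r2 ⊆-refl (∈-∷⁺ʳ (there (here refl)) (++⊆ (⊆-trans dsB (∷⁺ʳ _ (λ j → there (∈-++⁺ˡ j)))) (λ j → there (there (∈-++⁺ʳ (Ds Σ') j))))))
              (λ ()) (λ ()) (λ j → there (∈-++⁺ˡ j)) (∈-∷⁺ʳ (here refl) (λ ())) (λ ()) (λ ()))

    cpc0 : ∀ {Δ} → hasW0C0r S → Der S (A ∷ Γ) Δ → Der S Γ (B ∷ Δ) → Der S Γ Δ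
    cpc0 {Δ} h a b =
      discharge-c0 h f σ1 ch1 (weakenᴰ e ⊆-refl ⊆-refl)
      where
      c : Der S Γ (A ∷ Ds Σ1 ++ Δ)
      c = cutB (weakenᴰ b ⊆-refl (∷⁺ʳ _ (λ j → there (∈-++⁺ʳ (Ds Σ1) j))))
               (der (weaken q1 (∷⁺ʳ _ (λ ())) (∷⁺ʳ _ ∈-++⁺ˡ)))
      e : Der S Γ (Ds Σ1 ++ Δ)
      e = cutA c (weakenᴰ a ⊆-refl (∈-++⁺ʳ (Ds Σ1)))
      f : ∀ {C a'} → HDer S n (C ∷ []) (A ∷ a') → Der S (C ∷ Γ) (a' ++ Δ)
      f q = cutA (der (weaken q (∷⁺ʳ _ (λ ())) (∷⁺ʳ _ ∈-++⁺ˡ))) (weakenᴰ a (∷⁺ʳ _ there) (∈-++⁺ʳ _))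

  module LeftWn {Γ : List Fm} {n : ℕ} {Σ1 : List (Fm × Fm)} (σ1 : Σ≼ Σ1 ⊆ Γ)
    (ch1 : Chain (λ C a → HDer S n (C ∷ []) (A ∷ a)) Σ1 []) where

    wnE : ∀ {Δ E F m Σ2} → hasWnr S → (E ≼ F) ∈ Δ → Σ≼ Σ2 ⊆ (A ≼ B) ∷ Γ → (A ≼ B) ∈ Σ≼ Σ2 →
      Chain (λ C a → HDer S m (C ∷ []) (E ∷ a)) Σ2 [] → Der S Γ (A ∷ Ds Σ1 ++ Δ) → Der S Γ Δ
    wnE {Δ} {E} {F} {Σ2 = Σ2} h i σ2 inX ch2 r1
      with splice-chain A B cutA [] (E ∷ []) [] [] [] ⊆-refl ⊆-refl Σ2 σ2 inX (chain-map pad ch2) Σ1 σ1 (chain-map pad ch1)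
    ... | Σ' , σ' , ch' , ds1 , elim =
      wnᴰ h i σ' (chain-map unpad ch')
        (elim (weakenᴰ r1 ⊆-refl (∷⁺ʳ _ (++⊆ (λ j → there (∈-++⁺ˡ (ds1 j))) (λ j → there (∈-++⁺ʳ (Ds Σ') j)))))
              (λ ()) (λ j → there (∈-++⁺ˡ j)) (∈-∷⁺ʳ (here refl) (λ ())) (λ ()))

    wntr : ∀ {Δ Σ2} → hasTr S → Σ≼ Σ2 ⊆ (A ≼ B) ∷ Γ → (A ≼ B) ∈ Σ≼ Σ2 → ∀ {m} →
      Chain (λ C a → HDer S m (C ∷ []) a) Σ2 [] → Der S Γ (A ∷ Ds Σ1 ++ Δ) → Der S Γ Δ
    wntr {Δ} {Σ2} h σ2 inX ch2 r1
      with splice-chain A B cutA [] [] [] [] [] ⊆-refl ⊆-refl Σ2 σ2 inX (chain-map pad₀ ch2) Σ1 σ1 (chain-map pad ch1)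
    ... | Σ' , σ' , ch' , ds1 , elim =
      trᴰ h σ' (chain-map unpad₀ ch')
        (elim (weakenᴰ r1 ⊆-refl (∷⁺ʳ _ (++⊆ (λ j → ∈-++⁺ˡ (ds1 j)) (∈-++⁺ʳ (Ds Σ')))))
              (λ ()) ∈-++⁺ˡ (λ ()) (λ ()))

  w0cp : ∀ {Γ Δ E F m Σ2} → hasW0C0r S → (E ≼ F) ∈ Δ → Σ≼ Σ2 ⊆ (A ≼ B) ∷ Γ → (A ≼ B) ∈ Σ≼ Σ2 →
    Chain (λ C a → HDer S m (C ∷ []) (E ∷ a)) Σ2 [] → Der S Γ (A ∷ Δ) → Der S Γ Δ
  w0cp {Γ} {Δ} {E} {F} {Σ2 = Σ2} h i σ2 inX ch2 r1
    with splice-chain {Γ = Γ} A B cutA [] (E ∷ []) [] [] [] ⊆-refl ⊆-refl Σ2 σ2 inX (chain-map pad ch2) [] (λ ()) []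
  ... | Σ' , σ' , ch' , _ , elim = discharge-c0 h f σ' ch' u
    where
    t : Der S Γ (E ∷ Ds Σ' ++ Δ)
    t = elim (weakenᴰ r1 ⊆-refl (∷⁺ʳ _ (λ j → there (∈-++⁺ʳ (Ds Σ') j)))) (λ ()) (λ j → there (∈-++⁺ˡ j)) (∈-∷⁺ʳ (here refl) (λ ())) (λ ())
    u : Der S Γ (Ds Σ' ++ Δ)
    u = w0ᴰ h (∈-++⁺ʳ (Ds Σ') i) t
    f : ∀ {C a} → Der S (C ∷ []) (E ∷ a ++ []) → Der S (C ∷ Γ) (a ++ Δ)
    f {C} {a} q = w0ᴰ h (∈-++⁺ʳ a i) (weakenᴰ q (∷⁺ʳ _ (λ ())) (∷⁺ʳ _ (++⊆ {xs = a} ∈-++⁺ˡ (λ ()))))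

  -- The cut formula has already been cut away from ch1 and q1.
  module LeftAr {Γ Δ : List Fm} {Σ1 : List (Fm × Fm)} (σ1 : Σ≼ Σ1 ⊆ Γ)
    (ch1 : Chain (λ C a → Der S (C ∷ prefs Γ) (A ∷ a ++ prefs Δ)) Σ1 [])
    (q1 : Der S (B ∷ prefs Γ) (A ∷ Ds Σ1 ++ prefs Δ)) where

    arar : ∀ {E F Σ2} → hasAr S → (E ≼ F) ∈ Δ → Σ≼ Σ2 ⊆ (A ≼ B) ∷ Γ → (A ≼ B) ∈ Σ≼ Σ2 →
      Chain (λ C a → Der S (C ∷ prefs Γ) (E ∷ a ++ prefs Δ)) Σ2 [] → Der S (F ∷ prefs Γ) (E ∷ Ds Σ2 ++ prefs Δ) → Der S Γ Δ
    arar {E} {F} {Σ2} h i σ2 inX ch2 q2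
      with splice-cp A B cutA cutB (prefs Γ) (E ∷ []) (prefs Δ) (prefs Γ) (prefs Δ) ⊆-refl ⊆-refl Σ2 σ2 inX ch2 Σ1 σ1 ch1 q1
    ... | Σ' , σ' , ch' , dsB , elim =
      arᴰ h i σ' ch'
        (elim (weakenᴰ q2 ⊆-refl (∈-∷⁺ʳ (there (here refl)) (++⊆ (⊆-trans dsB (∷⁺ʳ _ (λ j → there (∈-++⁺ˡ j)))) (λ j → there (there (∈-++⁺ʳ (Ds Σ') j))))))
              there there (λ j → there (∈-++⁺ˡ j)) (∈-∷⁺ʳ (here refl) (λ ())) (λ j → there (∈-++⁺ʳ (Ds Σ') j)) (λ j → there (∈-++⁺ʳ (Ds Σ') j)))

    arnar : ∀ {Σ2} → hasNAr S → Σ≼ Σ2 ⊆ (A ≼ B) ∷ Γ → (A ≼ B) ∈ Σ≼ Σ2 →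
      Chain (λ C a → Der S (C ∷ prefs Γ) (a ++ prefs Δ)) Σ2 [] → Der S (prefs Γ) (Ds Σ2 ++ prefs Δ) → Der S Γ Δ
    arnar {Σ2} h σ2 inX ch2 q2
      with splice-cp A B cutA cutB (prefs Γ) [] (prefs Δ) (prefs Γ) (prefs Δ) ⊆-refl ⊆-refl Σ2 σ2 inX ch2 Σ1 σ1 ch1 q1
    ... | Σ' , σ' , ch' , dsB , elim =
      nar-or-empty h Σ' σ' ch'
        (elim (weakenᴰ q2 ⊆-refl (++⊆ (⊆-trans dsB (∷⁺ʳ _ ∈-++⁺ˡ)) (λ j → there (∈-++⁺ʳ (Ds Σ') j))))
              ⊆-refl ⊆-refl ∈-++⁺ˡ (λ ()) (∈-++⁺ʳ (Ds Σ')) (∈-++⁺ʳ (Ds Σ')))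

-- The cut formula is principal in the last rule, or is a ≼-formula kept in
-- the boxed succedent of a last Ar or N^A rule.
data Principal {S : Sys} : ∀ {X n Γ Δ} → HDer S n Γ (X ∷ Δ) → Set where
  pImp : ∀ {n Γ Δ A B} (d : HDer S n (A ∷ Γ) (B ∷ (A ⊃ B) ∷ Δ)) → Principal {Δ = Δ} (impR (here refl) d)
  pCP  : ∀ {n Γ Δ A B Σ} (h : hasCPr S) (σ : Σ≼ Σ ⊆ Γ) (ch : Chain (λ C a → HDer S n (C ∷ []) (A ∷ a)) Σ [])
         (d : HDer S n (B ∷ []) (A ∷ Ds Σ)) → Principal {Δ = Δ} (cp h (here refl) σ ch d)
  pWn  : ∀ {n Γ Δ A B Σ} (h : hasWnr S) (σ : Σ≼ Σ ⊆ Γ) (ch : Chain (λ C a → HDer S n (C ∷ []) (A ∷ a)) Σ [])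
         (d : HDer S n Γ (A ∷ Ds Σ ++ (A ≼ B) ∷ Δ)) → Principal (wn h (here refl) σ ch d)
  pW0  : ∀ {n Γ Δ A B} (h : hasW0C0r S) (d : HDer S n Γ (A ∷ (A ≼ B) ∷ Δ)) → Principal (w0 h (here refl) d)
  pAr  : ∀ {n Γ Δ A B Σ} (h : hasAr S) (σ : Σ≼ Σ ⊆ Γ)
         (ch : Chain (λ C a → HDer S n (C ∷ prefs Γ) (A ∷ a ++ (A ≼ B) ∷ prefs Δ)) Σ [])
         (d : HDer S n (B ∷ prefs Γ) (A ∷ Ds Σ ++ (A ≼ B) ∷ prefs Δ)) → Principal {Δ = Δ} (ar h (here refl) σ ch d)
  bAr  : ∀ {n Γ Δ X E F Σ} → Is≼ X → (h : hasAr S) (j : (E ≼ F) ∈ Δ) (σ : Σ≼ Σ ⊆ Γ)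
         (ch : Chain (λ C a → HDer S n (C ∷ prefs Γ) (E ∷ a ++ prefs (X ∷ Δ))) Σ [])
         (d : HDer S n (F ∷ prefs Γ) (E ∷ Ds Σ ++ prefs (X ∷ Δ))) → Principal {X = X} {Δ = Δ} (ar h (there j) σ ch d)
  bNar : ∀ {n Γ Δ X Σ} → Is≼ X → (h : hasNAr S) (l : 0 < length Σ) (σ : Σ≼ Σ ⊆ Γ)
         (ch : Chain (λ C a → HDer S n (C ∷ prefs Γ) (a ++ prefs (X ∷ Δ))) Σ [])
         (d : HDer S n (prefs Γ) (Ds Σ ++ prefs (X ∷ Δ))) → Principal {X = X} {Δ = Δ} (nar h l σ ch d)

¬Principal-atom : ∀ {S p n Γ Δ} {d : HDer S n Γ (atom p ∷ Δ)} → Principal d → ⊥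
¬Principal-atom (bAr () _ _ _ _ _)
¬Principal-atom (bNar () _ _ _ _ _)

¬Principal-bot : ∀ {S n Γ Δ} {d : HDer S n Γ (bot ∷ Δ)} → Principal d → ⊥
¬Principal-bot (bAr () _ _ _ _ _)
¬Principal-bot (bNar () _ _ _ _ _)

frontDs : ∀ {X A : Fm} Ds Δ → A ∷ Ds ++ X ∷ Δ ⊆ X ∷ A ∷ Ds ++ Δ
frontDs {X} {A} Ds Δ (here e) = there (here e)
frontDs Ds Δ (there i) with ∈-++⁻ Ds i
... | inj₁ j = there (there (∈-++⁺ˡ j))
... | inj₂ (here e) = here e
... | inj₂ (there j) = there (there (∈-++⁺ʳ Ds j))

frontDs0 : ∀ {X : Fm} Ds Δ → Ds ++ X ∷ Δ ⊆ X ∷ Ds ++ Δ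
frontDs0 Ds Δ i with ∈-++⁻ Ds i
... | inj₁ j = there (∈-++⁺ˡ j)
... | inj₂ (here e) = here e
... | inj₂ (there j) = there (∈-++⁺ʳ Ds j)

inDs : ∀ {X : Fm} Ds {Δ} → X ∷ Δ ⊆ X ∷ Ds ++ Δ
inDs Ds = ∷⁺ʳ _ (∈-++⁺ʳ Ds)

inADs : ∀ {X A : Fm} Ds {Δ} → X ∷ Δ ⊆ X ∷ A ∷ Ds ++ Δ
inADs Ds = ∷⁺ʳ _ (λ j → there (∈-++⁺ʳ Ds j))

pfx : ∀ {E : Fm} a Δ → prefs Δ ⊆ E ∷ a ++ prefs Δ
pfx a Δ j = there (∈-++⁺ʳ a j)

pfx0 : ∀ a Δ → prefs Δ ⊆ a ++ prefs Δ
pfx0 a Δ j = ∈-++⁺ʳ a j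

-- Termination: lexicographic in the cut formula, then the height of the
-- left premise, then that of the right premise.
mutual
  cut : ∀ {S} X n m {Γ Δ} → HDer S n Γ (X ∷ Δ) → HDer S m (X ∷ Γ) Δ → Der S Γ Δ
  cut X n m {Γ} {Δ} d1 d2 with X ∈? Γ | X ∈? Δ
  ... | yes i | _ = m , weaken d2 (∈-∷⁺ʳ i ⊆-refl) ⊆-refl
  ... | no _ | yes j = n , weaken d1 ⊆-refl (∈-∷⁺ʳ j ⊆-refl)
  ... | no nΓ | no nΔ = cut-left X n m nΓ nΔ d1 d2

  cutᴰ : ∀ {S} X {Γ Δ} → Der S Γ (X ∷ Δ) → Der S (X ∷ Γ) Δ → Der S Γ Δ
  cutᴰ X (n , d1) (m , d2) = cut X n m d1 d2

  cut-left : ∀ {S} X n m {Γ Δ} → X ∉ Γ → X ∉ Δ → HDer S n Γ (X ∷ Δ) → HDer S m (X ∷ Γ) Δ → Der S Γ Δ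
  cut-left X n m nΓ nΔ (init i (here refl)) d2 = ⊥-elim (nΓ i)
  cut-left X n m nΓ nΔ (init i (there j)) d2 = 0 , init i j
  cut-left X n m nΓ nΔ (botL i) d2 = 0 , botL i
  cut-left X n@(suc n') m nΓ nΔ (impL i d e) d2 =
    impLᴰ i (cut X n' m (weaken d ⊆-refl swap⊆) (weaken d2 ⊆-refl there)) (cut X n' m e (weaken d2 (∷⁺ʳ _ there) ⊆-refl))
  cut-left X n@(suc n') m nΓ nΔ d1@(impR (here refl) d) d2 = cut-right X n m nΓ nΔ d1 (pImp d) d2
  cut-left X n@(suc n') m nΓ nΔ (impR (there j) d) d2 =
    impRᴰ j (cut X n' m (weaken d ⊆-refl swap⊆) (weaken d2 (∷⁺ʳ _ there) there))
  cut-left X n@(suc n') m nΓ nΔ d1@(cp h (here refl) σ ch d) d2 = cut-right X n m nΓ nΔ d1 (pCP h σ ch d) d2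
  cut-left X n@(suc n') m nΓ nΔ (cp h (there j) σ ch d) d2 = n , cp h j σ ch d
  cut-left X n@(suc n') m nΓ nΔ (nr h l σ ch d) d2 = n , nr h l σ ch d
  cut-left X n@(suc n') m {Γ} {Δ} nΓ nΔ (tr h {Σ = Σ} σ ch d) d2 =
    trᴰ h σ (chain-map der ch) (cut X n' m (weaken d ⊆-refl (frontDs0 (Ds Σ) Δ)) (weaken d2 ⊆-refl (∈-++⁺ʳ (Ds Σ))))
  cut-left X n@(suc n') m nΓ nΔ d1@(wn h (here refl) σ ch d) d2 = cut-right X n m nΓ nΔ d1 (pWn h σ ch d) d2
  cut-left X n@(suc n') m {Γ} {Δ} nΓ nΔ (wn h {Σ = Σ} (there j) σ ch d) d2 =
    wnᴰ h j σ (chain-map der ch) (cut X n' m (weaken d ⊆-refl (frontDs (Ds Σ) Δ)) (weaken d2 ⊆-refl (λ k → there (∈-++⁺ʳ (Ds Σ) k))))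
  cut-left X n@(suc n') m nΓ nΔ d1@(w0 h (here refl) d) d2 = cut-right X n m nΓ nΔ d1 (pW0 h d) d2
  cut-left X n@(suc n') m nΓ nΔ (w0 h (there j) d) d2 = w0ᴰ h j (cut X n' m (weaken d ⊆-refl swap⊆) (weaken d2 ⊆-refl there))
  cut-left X n@(suc n') m nΓ nΔ (c0 h i d e) d2 =
    c0ᴰ h i (cut X n' m d (weaken d2 (∷⁺ʳ _ there) ⊆-refl)) (cut X n' m (weaken e ⊆-refl swap⊆) (weaken d2 ⊆-refl there))
  cut-left X n@(suc n') m nΓ nΔ d1@(ar h (here refl) σ ch d) d2 = cut-right X n m nΓ nΔ d1 (pAr h σ ch d) d2
  cut-left X n@(suc n') m {Γ} {Δ} nΓ nΔ d1@(ar h (there j) σ ch d) d2 =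
    cut-left-ar X n m nΓ nΔ d1 (is≼? X) (λ p → bAr p h j σ ch d) (λ np → n , ar-prefs⊆ Γ (X ∷ Δ) h j σ ⊆-refl (prefs-∷-¬Is≼ Δ np) ch d) d2
  cut-left X n@(suc n') m {Γ} {Δ} nΓ nΔ d1@(nar h l σ ch d) d2 =
    cut-left-ar X n m nΓ nΔ d1 (is≼? X) (λ p → bNar p h l σ ch d) (λ np → n , nar-prefs⊆ Γ (X ∷ Δ) h l σ ⊆-refl (prefs-∷-¬Is≼ Δ np) ch d) d2

  cut-left-ar : ∀ {S} X n m {Γ Δ} → X ∉ Γ → X ∉ Δ → (d1 : HDer S n Γ (X ∷ Δ)) → Dec (Is≼ X) → (Is≼ X → Principal d1) →
    (¬ Is≼ X → Der S Γ Δ) → HDer S m (X ∷ Γ) Δ → Der S Γ Δ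
  cut-left-ar X n m nΓ nΔ d1 (yes p) mk r d2 = cut-right X n m nΓ nΔ d1 (mk p) d2
  cut-left-ar X n m nΓ nΔ d1 (no np) mk r d2 = r np

  cut-right : ∀ {S} X n m {Γ Δ} → X ∉ Γ → X ∉ Δ → (d1 : HDer S n Γ (X ∷ Δ)) → Principal d1 → HDer S m (X ∷ Γ) Δ → Der S Γ Δ
  cut-right X n m nΓ nΔ d1 p (init (here refl) j) = ⊥-elim (¬Principal-atom p)
  cut-right X n m nΓ nΔ d1 p (init (there i) j) = 0 , init i j
  cut-right X n m nΓ nΔ d1 p (botL (here refl)) = ⊥-elim (¬Principal-bot p)
  cut-right X n m nΓ nΔ d1 p (botL (there i)) = 0 , botL i
  cut-right X n (suc m) nΓ nΔ d1 p (impL (there i) da db) =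
    impLᴰ i (cut X n m (weaken d1 ⊆-refl (∷⁺ʳ _ there)) da) (cut X n m (weaken d1 there ⊆-refl) (weaken db swap⊆ ⊆-refl))
  cut-right X@(A ⊃ B) n@(suc n') m@(suc m') nΓ nΔ d1 (pImp d) d2@(impL (here refl) da db) =
    let r1 = cut X n' m (weaken d ⊆-refl swap⊆) (weaken d2 (∷⁺ʳ _ there) there)
        ra = cut X n m' (weaken d1 ⊆-refl (∷⁺ʳ _ there)) da
        rb = cut X n m' (weaken d1 there ⊆-refl) (weaken db swap⊆ ⊆-refl)
    in cutᴰ B (cutᴰ A (weakenᴰ ra ⊆-refl (∷⁺ʳ _ there)) r1) rb
  cut-right X n m nΓ nΔ d1 (bAr () _ _ _ _ _) (impL (here refl) da db)
  cut-right X n m nΓ nΔ d1 (bNar () _ _ _ _ _) (impL (here refl) da db)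
  cut-right X n (suc m) nΓ nΔ d1 p (impR i d) = impRᴰ i (cut X n m (weaken d1 there (∷⁺ʳ _ there)) (weaken d swap⊆ ⊆-refl))
  cut-right X n (suc m) nΓ nΔ d1 p (cp h {Σ = Σ} i σ ch d) = cut-right-cp X n m nΓ nΔ d1 p h i σ ch d (X ∈? Σ≼ Σ)
  cut-right X n (suc m) nΓ nΔ d1 p (nr h {Σ = Σ} l σ ch d) = cut-right-nr X n m nΓ nΔ d1 p h l σ ch d (X ∈? Σ≼ Σ)
  cut-right X n (suc m) nΓ nΔ d1 p (tr h {Σ = Σ} σ ch d) = cut-right-tr X n m nΓ nΔ d1 p h σ ch d (X ∈? Σ≼ Σ)
  cut-right X n (suc m) nΓ nΔ d1 p (wn h {Σ = Σ} i σ ch d) = cut-right-wn X n m nΓ nΔ d1 p h i σ ch d (X ∈? Σ≼ Σ)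
  cut-right X n (suc m) nΓ nΔ d1 p (w0 h i d) = w0ᴰ h i (cut X n m (weaken d1 ⊆-refl (∷⁺ʳ _ there)) d)
  cut-right X n (suc m) nΓ nΔ d1 p (c0 h (there i) da db) =
    c0ᴰ h i (cut X n m (weaken d1 there ⊆-refl) (weaken da swap⊆ ⊆-refl)) (cut X n m (weaken d1 ⊆-refl (∷⁺ʳ _ there)) db)
  cut-right X n (suc m) nΓ nΔ d1 p d2@(c0 h (here refl) da db) = cut-right-c0 X n m nΓ nΔ d1 p h da db refl d2
  cut-right X n (suc m) nΓ nΔ d1 p (ar h {Σ = Σ} i σ ch d) = cut-right-ar X n m nΓ nΔ d1 p h i σ ch d (X ∈? Σ≼ Σ)
  cut-right X n (suc m) nΓ nΔ d1 p (nar h {Σ = Σ} l σ ch d) = cut-right-nar X n m nΓ nΔ d1 p h l σ ch d (X ∈? Σ≼ Σ)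

  cut-right-cp : ∀ {S} X n m {Γ Δ E F Σ} → X ∉ Γ → X ∉ Δ → (d1 : HDer S n Γ (X ∷ Δ)) → Principal d1 →
    (h : hasCPr S) (i : (E ≼ F) ∈ Δ) (σ : Σ≼ Σ ⊆ X ∷ Γ) (ch : Chain (λ C a → HDer S m (C ∷ []) (E ∷ a)) Σ [])
    (d : HDer S m (F ∷ []) (E ∷ Ds Σ)) → Dec (X ∈ Σ≼ Σ) → Der S Γ Δ
  cut-right-cp X n m nΓ nΔ d1 p h i σ ch d (no nX) = suc m , cp h i (⊆∷∧∉⇒⊆ σ nX) ch d
  cut-right-cp X n m nΓ nΔ d1 (pImp _) h i σ ch d (yes inX) = ⊥-elim (∈-Σ≼⇒Is≼ _ inX)
  cut-right-cp (A ≼ B) (suc n) m nΓ nΔ d1 (pCP h1 σ1 ch1 q1) h i σ ch d (yes inX) =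
    PrincipalCases.LeftCP.cpcp (cutᴰ A) (cutᴰ B) σ1 ch1 q1 h i σ inX ch d
  cut-right-cp (A ≼ B) (suc n) m {Γ} {Δ} nΓ nΔ d1 (pWn {Σ = Σ1} h1 σ1 ch1 r1) h i σ ch d (yes inX) =
    PrincipalCases.LeftWn.wnE (cutᴰ A) (cutᴰ B) σ1 ch1 h1 i σ inX ch
      (cut (A ≼ B) n (suc m) (weaken r1 ⊆-refl (frontDs (Ds Σ1) Δ)) (weaken (cp h i σ ch d) ⊆-refl (λ k → there (∈-++⁺ʳ (Ds Σ1) k))))
  cut-right-cp (A ≼ B) (suc n) m nΓ nΔ d1 (pW0 h1 r1) h i σ ch d (yes inX) =
    PrincipalCases.w0cp (cutᴰ A) (cutᴰ B) h1 i σ inX ch (cut (A ≼ B) n (suc m) (weaken r1 ⊆-refl swap⊆) (weaken (cp h i σ ch d) ⊆-refl there))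
  cut-right-cp X n m nΓ nΔ d1 (pAr h1 _ _ _) h i σ ch d (yes inX) = ⊥-elim (¬cp∧ar h h1)
  cut-right-cp X n m nΓ nΔ d1 (bAr _ h1 _ _ _ _) h i σ ch d (yes inX) = ⊥-elim (¬cp∧ar h h1)
  cut-right-cp X n m nΓ nΔ d1 (bNar _ h1 _ _ _ _) h i σ ch d (yes inX) = ⊥-elim (¬cp∧nar h h1)

  cut-right-nr : ∀ {S} X n m {Γ Δ Σ} → X ∉ Γ → X ∉ Δ → (d1 : HDer S n Γ (X ∷ Δ)) → Principal d1 →
    (h : hasNr S) (l : 0 < length Σ) (σ : Σ≼ Σ ⊆ X ∷ Γ) (ch : Chain (λ C a → HDer S m (C ∷ []) a) Σ [])
    (d : HDer S m [] (Ds Σ)) → Dec (X ∈ Σ≼ Σ) → Der S Γ Δ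
  cut-right-nr X n m nΓ nΔ d1 p h l σ ch d (no nX) = suc m , nr h l (⊆∷∧∉⇒⊆ σ nX) ch d
  cut-right-nr X n m nΓ nΔ d1 (pImp _) h l σ ch d (yes inX) = ⊥-elim (∈-Σ≼⇒Is≼ _ inX)
  cut-right-nr (A ≼ B) (suc n) m nΓ nΔ d1 (pCP h1 σ1 ch1 q1) h l σ ch d (yes inX) =
    PrincipalCases.LeftCP.cpnr (cutᴰ A) (cutᴰ B) σ1 ch1 q1 h σ inX ch d
  cut-right-nr X n m nΓ nΔ d1 (pWn h1 _ _ _) h l σ ch d (yes inX) = ⊥-elim (¬wn∧nr h1 h)
  cut-right-nr X n m nΓ nΔ d1 (pW0 h1 _) h l σ ch d (yes inX) = ⊥-elim (¬w0∧nr h1 h)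
  cut-right-nr X n m nΓ nΔ d1 (pAr h1 _ _ _) h l σ ch d (yes inX) = ⊥-elim (¬ar∧nr h1 h)
  cut-right-nr X n m nΓ nΔ d1 (bAr _ h1 _ _ _ _) h l σ ch d (yes inX) = ⊥-elim (¬ar∧nr h1 h)
  cut-right-nr X n m nΓ nΔ d1 (bNar _ h1 _ _ _ _) h l σ ch d (yes inX) = ⊥-elim (¬nar∧nr h1 h)

  cut-right-tr : ∀ {S} X n m {Γ Δ Σ} → X ∉ Γ → X ∉ Δ → (d1 : HDer S n Γ (X ∷ Δ)) → Principal d1 →
    (h : hasTr S) (σ : Σ≼ Σ ⊆ X ∷ Γ) (ch : Chain (λ C a → HDer S m (C ∷ []) a) Σ [])
    (d : HDer S m (X ∷ Γ) (Ds Σ ++ Δ)) → Dec (X ∈ Σ≼ Σ) → Der S Γ Δ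
  cut-right-tr X n m {Σ = Σ} nΓ nΔ d1 p h σ ch d (no nX) =
    trᴰ h (⊆∷∧∉⇒⊆ σ nX) (chain-map der ch) (cut X n m (weaken d1 ⊆-refl (inDs (Ds Σ))) d)
  cut-right-tr X n m nΓ nΔ d1 (pImp _) h σ ch d (yes inX) = ⊥-elim (∈-Σ≼⇒Is≼ _ inX)
  cut-right-tr (A ≼ B) n@(suc n') m {Σ = Σ} nΓ nΔ d1 (pCP h1 σ1 ch1 q1) h σ ch d (yes inX) =
    PrincipalCases.LeftCP.cptr (cutᴰ A) (cutᴰ B) σ1 ch1 q1 h σ inX ch (cut (A ≼ B) n m (weaken d1 ⊆-refl (inDs (Ds Σ))) d)
  cut-right-tr (A ≼ B) (suc n) m {Γ} {Δ} nΓ nΔ d1 (pWn {Σ = Σ1} h1 σ1 ch1 r1) h σ ch d (yes inX) =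
    PrincipalCases.LeftWn.wntr (cutᴰ A) (cutᴰ B) σ1 ch1 h σ inX ch
      (cut (A ≼ B) n (suc m) (weaken r1 ⊆-refl (frontDs (Ds Σ1) Δ)) (weaken (tr h σ ch d) ⊆-refl (λ k → there (∈-++⁺ʳ (Ds Σ1) k))))
  cut-right-tr X n m nΓ nΔ d1 (pW0 h1 _) h σ ch d (yes inX) = ⊥-elim (¬w0∧tr h1 h)
  cut-right-tr X n m nΓ nΔ d1 (pAr h1 _ _ _) h σ ch d (yes inX) = ⊥-elim (¬ar∧tr h1 h)
  cut-right-tr X n m nΓ nΔ d1 (bAr _ h1 _ _ _ _) h σ ch d (yes inX) = ⊥-elim (¬ar∧tr h1 h)
  cut-right-tr X n m nΓ nΔ d1 (bNar _ h1 _ _ _ _) h σ ch d (yes inX) = ⊥-elim (¬nar∧tr h1 h)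

  cut-right-wn : ∀ {S} X n m {Γ Δ E F Σ} → X ∉ Γ → X ∉ Δ → (d1 : HDer S n Γ (X ∷ Δ)) → Principal d1 →
    (h : hasWnr S) (i : (E ≼ F) ∈ Δ) (σ : Σ≼ Σ ⊆ X ∷ Γ) (ch : Chain (λ C a → HDer S m (C ∷ []) (E ∷ a)) Σ [])
    (d : HDer S m (X ∷ Γ) (E ∷ Ds Σ ++ Δ)) → Dec (X ∈ Σ≼ Σ) → Der S Γ Δ
  cut-right-wn X n m {Σ = Σ} nΓ nΔ d1 p h i σ ch d (no nX) =
    wnᴰ h i (⊆∷∧∉⇒⊆ σ nX) (chain-map der ch) (cut X n m (weaken d1 ⊆-refl (inADs (Ds Σ))) d)
  cut-right-wn X n m nΓ nΔ d1 (pImp _) h i σ ch d (yes inX) = ⊥-elim (∈-Σ≼⇒Is≼ _ inX)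
  cut-right-wn (A ≼ B) n@(suc n') m {Σ = Σ} nΓ nΔ d1 (pCP h1 σ1 ch1 q1) h i σ ch d (yes inX) =
    PrincipalCases.LeftCP.cpwn (cutᴰ A) (cutᴰ B) σ1 ch1 q1 h i σ inX ch (cut (A ≼ B) n m (weaken d1 ⊆-refl (inADs (Ds Σ))) d)
  cut-right-wn (A ≼ B) (suc n) m {Γ} {Δ} nΓ nΔ d1 (pWn {Σ = Σ1} h1 σ1 ch1 r1) h i σ ch d (yes inX) =
    PrincipalCases.LeftWn.wnE (cutᴰ A) (cutᴰ B) σ1 ch1 h i σ inX ch
      (cut (A ≼ B) n (suc m) (weaken r1 ⊆-refl (frontDs (Ds Σ1) Δ)) (weaken (wn h i σ ch d) ⊆-refl (λ k → there (∈-++⁺ʳ (Ds Σ1) k))))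
  cut-right-wn X n m nΓ nΔ d1 (pW0 h1 _) h i σ ch d (yes inX) = ⊥-elim (¬w0∧wn h1 h)
  cut-right-wn X n m nΓ nΔ d1 (pAr h1 _ _ _) h i σ ch d (yes inX) = ⊥-elim (¬ar∧wn h1 h)
  cut-right-wn X n m nΓ nΔ d1 (bAr _ h1 _ _ _ _) h i σ ch d (yes inX) = ⊥-elim (¬ar∧wn h1 h)
  cut-right-wn X n m nΓ nΔ d1 (bNar _ h1 _ _ _ _) h i σ ch d (yes inX) = ⊥-elim (¬nar∧wn h1 h)

  cut-right-c0 : ∀ {S} X n m {Γ Δ A B} → X ∉ Γ → X ∉ Δ → (d1 : HDer S n Γ (X ∷ Δ)) → Principal d1 →
    (h : hasW0C0r S) → HDer S m (A ∷ X ∷ Γ) Δ → HDer S m (X ∷ Γ) (B ∷ Δ) → X ≡ A ≼ B → HDer S (suc m) (X ∷ Γ) Δ → Der S Γ Δ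
  cut-right-c0 X n m nΓ nΔ d1 (pImp _) h da db () d2
  cut-right-c0 X n m nΓ nΔ d1 (pCP {A = A} {B} h1 σ1 ch1 q1) h da db refl d2 =
    PrincipalCases.LeftCP.cpc0 (cutᴰ A) (cutᴰ B) σ1 ch1 q1 h
      (cut X n m (weaken d1 there ⊆-refl) (weaken da swap⊆ ⊆-refl)) (cut X n m (weaken d1 ⊆-refl (∷⁺ʳ _ there)) db)
  cut-right-c0 X (suc n) m nΓ nΔ d1 (pW0 {A = A} h1 r1) h da db refl d2 =
    cutᴰ A (cut X n (suc m) (weaken r1 ⊆-refl swap⊆) (weaken d2 ⊆-refl there)) (cut X (suc n) m (weaken d1 there ⊆-refl) (weaken da swap⊆ ⊆-refl))
  cut-right-c0 X n m nΓ nΔ d1 (pWn h1 _ _ _) h da db e d2 = ⊥-elim (¬w0∧wn h h1)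
  cut-right-c0 X n m nΓ nΔ d1 (pAr h1 _ _ _) h da db e d2 = ⊥-elim (¬ar∧w0 h1 h)
  cut-right-c0 X n m nΓ nΔ d1 (bAr _ h1 _ _ _ _) h da db e d2 = ⊥-elim (¬ar∧w0 h1 h)
  cut-right-c0 X n m nΓ nΔ d1 (bNar _ h1 _ _ _ _) h da db e d2 = ⊥-elim (¬nar∧w0 h1 h)

  cut-boxed-ar : ∀ {S} X n M {Γ Δ E F Σ} → hasAr S → (E ≼ F) ∈ Δ → Σ≼ Σ ⊆ Γ →
    Chain (λ C a → HDer S n (C ∷ prefs Γ) (E ∷ a ++ prefs (X ∷ Δ))) Σ [] →
    HDer S n (F ∷ prefs Γ) (E ∷ Ds Σ ++ prefs (X ∷ Δ)) → (d2 : HDer S M (X ∷ Γ) Δ) → IsArNar d2 → Der S Γ Δ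
  cut-boxed-ar X n M {Γ} {Δ} {E} {F} {Σ} h j σ ch d d2 an =
    arᴰ h j σ (chain-map (λ {C} {a} q → cut X n M (weaken q ⊆-refl (mvX a)) (rebox d2 an (sx C) (pfx a Δ))) ch)
       (cut X n M (weaken d ⊆-refl (mvX (Ds Σ))) (rebox d2 an (sx F) (pfx (Ds Σ) Δ)))
    where
    mvX : ∀ a → E ∷ a ++ prefs (X ∷ Δ) ⊆ X ∷ E ∷ a ++ prefs Δ
    mvX a = ⊆-trans (∷⁺ʳ _ (++-mid⁺ [] {a} {a} (prefs (X ∷ Δ)) ⊆-refl)) (⊆-trans (∷⁺ʳ _ (++⊆ {xs = a} ∈-++⁺ˡ (⊆-trans (prefs-∷⊆ Δ) (∈-∷⁺ʳ (∈-++⁺ʳ a (here refl)) (λ k → ∈-++⁺ʳ a (there k)))))) (⊆-trans (∷⁺ʳ _ (frontDs0 a (prefs Δ))) swap⊆))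
    sx : ∀ C → prefs (X ∷ Γ) ⊆ X ∷ C ∷ prefs Γ
    sx C = ⊆-trans (prefs-∷⊆ Γ) (∷⁺ʳ _ there)

  cut-boxed-nar : ∀ {S} X n M {Γ Δ Σ} → hasNAr S → 0 < length Σ → Σ≼ Σ ⊆ Γ →
    Chain (λ C a → HDer S n (C ∷ prefs Γ) (a ++ prefs (X ∷ Δ))) Σ [] →
    HDer S n (prefs Γ) (Ds Σ ++ prefs (X ∷ Δ)) → (d2 : HDer S M (X ∷ Γ) Δ) → IsArNar d2 → Der S Γ Δ
  cut-boxed-nar X n M {Γ} {Δ} {Σ} h l σ ch d d2 an =
    narᴰ h l σ (chain-map (λ {C} {a} q → cut X n M (weaken q ⊆-refl (mvX a)) (rebox d2 an (⊆-trans (prefs-∷⊆ Γ) (∷⁺ʳ _ there)) (pfx0 a Δ))) ch)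
       (cut X n M (weaken d ⊆-refl (mvX (Ds Σ))) (rebox d2 an (prefs-∷⊆ Γ) (pfx0 (Ds Σ) Δ)))
    where
    mvX : ∀ a → a ++ prefs (X ∷ Δ) ⊆ X ∷ a ++ prefs Δ
    mvX a = ⊆-trans (++⊆ {xs = a} ∈-++⁺ˡ (⊆-trans (prefs-∷⊆ Δ) (∈-∷⁺ʳ (∈-++⁺ʳ a (here refl)) (λ k → ∈-++⁺ʳ a (there k))))) (frontDs0 a (prefs Δ))

  cut-right-ar : ∀ {S} X n m {Γ Δ E F Σ} → X ∉ Γ → X ∉ Δ → (d1 : HDer S n Γ (X ∷ Δ)) → Principal d1 →
    (h : hasAr S) (i : (E ≼ F) ∈ Δ) (σ : Σ≼ Σ ⊆ X ∷ Γ)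
    (ch : Chain (λ C a → HDer S m (C ∷ prefs (X ∷ Γ)) (E ∷ a ++ prefs Δ)) Σ [])
    (d : HDer S m (F ∷ prefs (X ∷ Γ)) (E ∷ Ds Σ ++ prefs Δ)) → Dec (X ∈ Σ≼ Σ) → Der S Γ Δ
  cut-right-ar X n m {Γ} {Δ} nΓ nΔ d1 (pImp _) h i σ ch d dec = suc m , ar-prefs⊆ (X ∷ Γ) Δ h i (⊆∷∧∉⇒⊆ σ (λ k → ∈-Σ≼⇒Is≼ _ k)) ⊆-refl ⊆-refl ch d
  cut-right-ar X n m nΓ nΔ d1 (pCP h1 _ _ _) h i σ ch d dec = ⊥-elim (¬cp∧ar h1 h)
  cut-right-ar X n m nΓ nΔ d1 (pWn h1 _ _ _) h i σ ch d dec = ⊥-elim (¬wn∧ar h1 h)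
  cut-right-ar X n m nΓ nΔ d1 (pW0 h1 _) h i σ ch d dec = ⊥-elim (¬w0∧ar h1 h)
  cut-right-ar X (suc n) m nΓ nΔ d1 (bAr _ h1 j σ1 ch1 q1) h i σ ch d dec = cut-boxed-ar X n (suc m) h1 j σ1 ch1 q1 (ar h i σ ch d) (isAr h i σ ch d)
  cut-right-ar X (suc n) m nΓ nΔ d1 (bNar _ h1 l1 σ1 ch1 q1) h i σ ch d dec = cut-boxed-nar X n (suc m) h1 l1 σ1 ch1 q1 (ar h i σ ch d) (isAr h i σ ch d)
  cut-right-ar X (suc n) m {Γ} {Δ} {Σ = Σ} nΓ nΔ d1 (pAr h1 σ1 ch1 q1) h i σ ch d (no nX) =
    arᴰ h i (⊆∷∧∉⇒⊆ σ nX)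
      (chain-map (λ {C} {a} q → cut X (suc n) m (rebox d1 (isAr h1 (here refl) σ1 ch1 q1) there (∷⁺ʳ _ (pfx a Δ))) (weaken q swap⊆ ⊆-refl)) ch)
      (cut X (suc n) m (rebox d1 (isAr h1 (here refl) σ1 ch1 q1) there (∷⁺ʳ _ (pfx (Ds Σ) Δ))) (weaken d swap⊆ ⊆-refl))
  cut-right-ar X (suc n) m {Γ} {Δ} {Σ = Σ} nΓ nΔ d1 (pAr {A = A} {B} {Σ = Σ1} h1 σ1 ch1 q1) h i σ ch d (yes inX) =
    PrincipalCases.LeftAr.arar (cutᴰ A) (cutᴰ B) σ1
      (chain-map (λ {C} {a} q → cut X n (suc m) (weaken q ⊆-refl (frontDs a (prefs Δ))) (rebox (ar h i σ ch d) (isAr h i σ ch d) (∷⁺ʳ _ there) (pfx a Δ))) ch1)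
      (cut X n (suc m) (weaken q1 ⊆-refl (frontDs (Ds Σ1) (prefs Δ))) (rebox (ar h i σ ch d) (isAr h i σ ch d) (∷⁺ʳ _ there) (pfx (Ds Σ1) Δ)))
      h i σ inX
      (chain-map (λ {C} {a} q → cut X (suc n) m (rebox d1 (isAr h1 (here refl) σ1 ch1 q1) there (∷⁺ʳ _ (pfx a Δ))) (weaken q swap⊆ ⊆-refl)) ch)
      (cut X (suc n) m (rebox d1 (isAr h1 (here refl) σ1 ch1 q1) there (∷⁺ʳ _ (pfx (Ds Σ) Δ))) (weaken d swap⊆ ⊆-refl))

  cut-right-nar : ∀ {S} X n m {Γ Δ Σ} → X ∉ Γ → X ∉ Δ → (d1 : HDer S n Γ (X ∷ Δ)) → Principal d1 →
    (h : hasNAr S) (l : 0 < length Σ) (σ : Σ≼ Σ ⊆ X ∷ Γ)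
    (ch : Chain (λ C a → HDer S m (C ∷ prefs (X ∷ Γ)) (a ++ prefs Δ)) Σ [])
    (d : HDer S m (prefs (X ∷ Γ)) (Ds Σ ++ prefs Δ)) → Dec (X ∈ Σ≼ Σ) → Der S Γ Δ
  cut-right-nar X n m {Γ} {Δ} nΓ nΔ d1 (pImp _) h l σ ch d dec = suc m , nar-prefs⊆ (X ∷ Γ) Δ h l (⊆∷∧∉⇒⊆ σ (λ k → ∈-Σ≼⇒Is≼ _ k)) ⊆-refl ⊆-refl ch d
  cut-right-nar X n m nΓ nΔ d1 (pCP h1 _ _ _) h l σ ch d dec = ⊥-elim (¬cp∧nar h1 h)
  cut-right-nar X n m nΓ nΔ d1 (pWn h1 _ _ _) h l σ ch d dec = ⊥-elim (¬wn∧nar h1 h)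
  cut-right-nar X n m nΓ nΔ d1 (pW0 h1 _) h l σ ch d dec = ⊥-elim (¬w0∧nar h1 h)
  cut-right-nar X (suc n) m nΓ nΔ d1 (bAr _ h1 j σ1 ch1 q1) h l σ ch d dec = cut-boxed-ar X n (suc m) h1 j σ1 ch1 q1 (nar h l σ ch d) (isNar h l σ ch d)
  cut-right-nar X (suc n) m nΓ nΔ d1 (bNar _ h1 l1 σ1 ch1 q1) h l σ ch d dec = cut-boxed-nar X n (suc m) h1 l1 σ1 ch1 q1 (nar h l σ ch d) (isNar h l σ ch d)
  cut-right-nar X (suc n) m {Γ} {Δ} {Σ = Σ} nΓ nΔ d1 (pAr h1 σ1 ch1 q1) h l σ ch d (no nX) =
    narᴰ h l (⊆∷∧∉⇒⊆ σ nX)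
      (chain-map (λ {C} {a} q → cut X (suc n) m (rebox d1 (isAr h1 (here refl) σ1 ch1 q1) there (∷⁺ʳ _ (pfx0 a Δ))) (weaken q swap⊆ ⊆-refl)) ch)
      (cut X (suc n) m (rebox d1 (isAr h1 (here refl) σ1 ch1 q1) ⊆-refl (∷⁺ʳ _ (pfx0 (Ds Σ) Δ))) d)
  cut-right-nar X (suc n) m {Γ} {Δ} {Σ = Σ} nΓ nΔ d1 (pAr {A = A} {B} {Σ = Σ1} h1 σ1 ch1 q1) h l σ ch d (yes inX) =
    PrincipalCases.LeftAr.arnar (cutᴰ A) (cutᴰ B) σ1
      (chain-map (λ {C} {a} q → cut X n (suc m) (weaken q ⊆-refl (frontDs a (prefs Δ))) (rebox (nar h {Δ = Δ} l σ ch d) (isNar {Δ = Δ} h l σ ch d) (∷⁺ʳ _ there) (pfx a Δ))) ch1)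
      (cut X n (suc m) (weaken q1 ⊆-refl (frontDs (Ds Σ1) (prefs Δ))) (rebox (nar h {Δ = Δ} l σ ch d) (isNar {Δ = Δ} h l σ ch d) (∷⁺ʳ _ there) (pfx (Ds Σ1) Δ)))
      h σ inX
      (chain-map (λ {C} {a} q → cut X (suc n) m (rebox d1 (isAr h1 (here refl) σ1 ch1 q1) there (∷⁺ʳ _ (pfx0 a Δ))) (weaken q swap⊆ ⊆-refl)) ch)
      (cut X (suc n) m (rebox d1 (isAr h1 (here refl) σ1 ch1 q1) ⊆-refl (∷⁺ʳ _ (pfx0 (Ds Σ) Δ))) d)

-- Hilbert derivations

⊃R : ∀ {S Γ Δ A B} → Der S (A ∷ Γ) (B ∷ Δ) → Der S Γ ((A ⊃ B) ∷ Δ)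
⊃R d = impRᴰ (here refl) (weakenᴰ d ⊆-refl (∷⁺ʳ _ there))

⊃R-invᴰ : ∀ {S Γ Δ A B} → Der S Γ ((A ⊃ B) ∷ Δ) → Der S (A ∷ Γ) (B ∷ Δ)
⊃R-invᴰ (n , d) = n , ⊃R-inv d ⊆-refl

⊃L : ∀ {S Γ Δ A B} → Der S Γ (A ∷ Δ) → Der S (B ∷ Γ) Δ → Der S ((A ⊃ B) ∷ Γ) Δ
⊃L d e = impLᴰ (here refl) (weakenᴰ d there ⊆-refl) (weakenᴰ e (∷⁺ʳ _ there) ⊆-refl)

botLᴰ : ∀ {S Γ Δ} → bot ∈ Γ → Der S Γ Δ
botLᴰ i = 0 , botL i

∧L : ∀ {S Γ Δ P Q} → Der S (P ∷ Q ∷ Γ) Δ → Der S ((P ∧' Q) ∷ Γ) Δ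
∧L d = ⊃L (⊃R (⊃R (weakenᴰ d swap⊆ there))) (botLᴰ (here refl))

⋀R : ∀ {S} Γ → Der S Γ (⋀ Γ ∷ [])
⋀R [] = ⊃R (botLᴰ (here refl))
⋀R (A ∷ Γ) = ⊃R (⊃L (identity A (here refl) (here refl)) (⊃L (weakenᴰ (⋀R Γ) there (∷⁺ʳ _ (λ ()))) (botLᴰ (here refl))))

⋁L : ∀ {S} Δ → Der S (⋁ Δ ∷ []) Δ
⋁L [] = botLᴰ (here refl)
⋁L (A ∷ Δ) = ⊃L (⊃R (identity A (here refl) (there (here refl)))) (weakenᴰ (⋁L Δ) ⊆-refl there)

hasN→ : ∀ {S} → hasN S → hasNr S ⊎ hasNAr S
hasN→ {NN} _ = inj₁ tt
hasN→ {NNA} _ = inj₂ tt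

hasT→ : ∀ {S} → hasT S → hasTr S ⊎ hasW0C0r S
hasT→ {NT} _ = inj₁ tt
hasT→ {NW} _ = inj₁ tt
hasT→ {NC} _ = inj₂ tt

hasW→ : ∀ {S} → hasW S → hasWnr S ⊎ hasW0C0r S
hasW→ {NW} _ = inj₁ tt
hasW→ {NC} _ = inj₂ tt

hasC→ : ∀ {S} → hasC S → hasW0C0r S
hasC→ {NC} _ = tt

hasA→ : ∀ {S} → hasA S → hasAr S
hasA→ {NA} _ = tt
hasA→ {NNA} _ = tt

hilbert⇒Der : ∀ {S φ} → S ⊢H φ → Der S [] (φ ∷ [])
hilbert⇒Der (axK A B) = ⊃R (⊃R (identity A (there (here refl)) (here refl)))
hilbert⇒Der (axS A B C) =
  ⊃R (⊃R (⊃R (impLᴰ (there (there (here refl))) (identity A (here refl) (here refl))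
     (impLᴰ (here refl) (impLᴰ (there (there (here refl))) (identity A (there (here refl)) (here refl)) (identity B (here refl) (here refl)))
        (identity C (here refl) (here refl))))))
hilbert⇒Der (axDN A) = ⊃R (⊃L (⊃R (identity A (here refl) (there (here refl)))) (botLᴰ (here refl)))
hilbert⇒Der (mp {A} d e) = cutᴰ A (weakenᴰ (hilbert⇒Der e) (λ ()) (∷⁺ʳ _ (λ ()))) (⊃R-invᴰ (hilbert⇒Der d))
hilbert⇒Der (cpr d) = cp-or-ar {Σ = []} (here refl) (λ ()) [] (⊃R-invᴰ (hilbert⇒Der d))
hilbert⇒Der (axTr A B C) = ⊃R (∧L (cp-or-ar {Σ = (A , B) ∷ (B , C) ∷ []} (here refl) (∈-∷⁺ʳ (here refl) (∈-∷⁺ʳ (there (here refl)) (λ ())))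
  (identity A (here refl) (here refl) ∷ (identity B (here refl) (there (here refl)) ∷ []))
  (identity C (here refl) (there (there (here refl))))))
hilbert⇒Der (axOr A B C) = ⊃R (∧L (cp-or-ar {Σ = (A , B) ∷ (A , C) ∷ []} (here refl) (∈-∷⁺ʳ (here refl) (∈-∷⁺ʳ (there (here refl)) (λ ())))
  (identity A (here refl) (here refl) ∷ (identity A (here refl) (here refl) ∷ []))
  (⊃L (⊃R (identity B (here refl) (there (there (here refl))))) (identity C (here refl) (there (there (here refl)))))))
hilbert⇒Der (axN h) with hasN→ h
... | inj₁ h' = ⊃R (nrᴰ {Σ = (bot , top) ∷ []} h' (s≤s z≤n) (∈-∷⁺ʳ (here refl) (λ ())) (botLᴰ (here refl) ∷ []) (⊃R (botLᴰ (here refl))))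
... | inj₂ h' = ⊃R (narᴰ {Σ = (bot , top) ∷ []} h' (s≤s z≤n) (∈-∷⁺ʳ (here refl) (λ ())) (botLᴰ (here refl) ∷ []) (⊃R (botLᴰ (here refl))))
hilbert⇒Der (axT h A) with hasT→ h
... | inj₁ h' = ⊃R (⊃R (trᴰ {Σ = (bot , A) ∷ []} h' (∈-∷⁺ʳ (there (here refl)) (λ ())) (botLᴰ (here refl) ∷ []) (identity A (here refl) (here refl))))
... | inj₂ h' = ⊃R (⊃R (c0ᴰ h' (there (here refl)) (botLᴰ (here refl)) (identity A (here refl) (here refl))))
hilbert⇒Der (axW h A) with hasW→ h
... | inj₁ h' = ⊃R (wnᴰ {Σ = []} h' (here refl) (λ ()) [] (identity A (here refl) (here refl)))
... | inj₂ h' = ⊃R (w0ᴰ h' (here refl) (identity A (here refl) (here refl)))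
hilbert⇒Der (axC h A) = ⊃R (c0ᴰ (hasC→ h) (here refl) (identity A (here refl) (here refl)) (⊃R (botLᴰ (here refl))))
hilbert⇒Der (axA- h A B) = ⊃R (arᴰ {Σ = []} (hasA→ h) (here refl) (λ ()) [] (⊃L (identity (A ≼ B) (here refl) (here refl)) (botLᴰ (here refl))))
hilbert⇒Der (axA h A B) = ⊃R (⊃L (arᴰ {Σ = []} (hasA→ h) (there (here refl)) (λ ()) [] (identity (A ≼ B) (here refl) (there (here refl)))) (botLᴰ (here refl)))

implication⇒sequent : ∀ {S} Γ Δ → Der S [] ((⋀ Γ ⊃ ⋁ Δ) ∷ []) → Der S Γ Δ
implication⇒sequent Γ Δ d =
  cutᴰ (⋀ Γ ⊃ ⋁ Δ) (weakenᴰ d (λ ()) (∷⁺ʳ _ (λ ())))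
    (⊃L (weakenᴰ (⋀R Γ) ⊆-refl (∷⁺ʳ _ (λ ()))) (weakenᴰ (⋁L Δ) (∷⁺ʳ _ (λ ())) ⊆-refl))

corollary4p4 : (L : Sys) (Γ Δ : List Fm) → L ⊢H (⋀ Γ ⊃ ⋁ Δ) → L ⊢ Γ ⇒ Δ
corollary4p4 L Γ Δ ⊢φ = Der⇒⊢ (implication⇒sequent Γ Δ (hilbert⇒Der ⊢φ))
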